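{- Let $D=(V,A)$ be a directed 4-hypergraph and $A(D,x)$ its adjacency 4-matrix with variables $x=(x_a)_{a\in A}$. Then $$\det(A(D,x))=\sum_{P=\{c_1,\ldots,c_k\}}\prod_i\Big(\mathrm{sign}(c_i)\prod_{a \text{ hyperedge of } c_i}x_a\Big),$$ where $P$ ranges over all sets of vertex-disjoint 4-circuits $c_i$ which contain directed hyperedges of $A$ only and cover all vertices of $D$, and $\mathrm{sign}(c_i)=\prod_z \mathrm{sign}(z)$ with $z$ ranging over all connector cycles of $c_i$ and $\mathrm{sign}(z)=(-1)^{|z|/2-1}$.
   Context: A directed 4-hypergraph: $V$ finite, linearly ordered, $A$ a set of ordered 4-tuples $(a_1,a_2,a_3,a_4)$ of distinct vertices. $A(D,x)$ is indexed by $V^4$ with entry $x_a$ at $a\in A$ and $0$ elsewhere; $\det(M)=\sum_{\alpha_1,\alpha_2,\alpha_3}\mathrm{sign}(\alpha_1)\mathrm{sign}(\alpha_2)\mathrm{sign}(\alpha_3)\prod_{i\in V}M_{(\alpha_1(i),\alpha_2(i),\alpha_3(i),i)}$ over triples of permutations of $V$. For a hyperedge $h=(a_1,a_2,a_3,a_4)$ introduce an edge-vertex $v(h)$ and colored arcs: white $(v(h),a_1)$, red $(v(h),a_2)$, green $(v(h),a_3)$, blue $(a_4,v(h))$; $a(h,v)$ is the colored arc between $v(h)$ and the vertex $v$ of $h$. For a set $S$ of hyperedges, $O(S)$ is the digraph on the vertices of elements of $S$ together with $\{v(h):h\in S\}$, with all colored arcs of elements of $S$. A connector is a 5-tuple $(h_1,h_2,h_3,h_4,v)$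 with $v\in V$ the $i$-th vertex of hyperedge $h_i$; its colored arcs are $a(h_i,v)$. A 4-circuit is a pair $(S,C)$, $S$ a set of hyperedges, $C$ a finite set of connectors, such that: (1) for each $h\in S$ and $i\in\{1,\ldots,4\}$ there is exactly one connector $(h_1,\ldots,h_4,v)\in C$ with $h_i=h$, and then $v$ is the $i$-th vertex of $h$; (2) every hyperedge of every connector of $C$ is in $S$; (3) $O(S)$ is weakly connected; (4) each vertex of $V$ lies in at most one connector of $C$. Vertex-disjoint means no vertex lies in connectors of two different 4-circuits; covering all vertices means every vertex lies in a connector of some $c_i$. Connector cycles of $(S,C)$: in the digraph whose vertices are the $v(h)$, $h\in S$, and the connectors of $C$, with an arc between $c$ and $v(h)$ whenever $a(h,v)$ is a colored arc of $c$ (same orientation and color as $a(h,v)$), the white (red, green) connector cycles are the directed cycles alternating between blue and white (red, green) arcs; $|z|$ is the number of arcs of the cycle $z$. -}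

module Defs where

open import Level using (Level)
open import Function using (_∘_)
open import Data.Nat as ℕ using (ℕ; zero; suc; _∸_; ⌊_/2⌋)
open import Data.Fin as F using (Fin; zero; suc; toℕ; fromℕ<)
open import Data.Fin.Properties using (all?; any?) renaming (_≟_ to _≟ᶠ_; _<?_ to _<ᶠ?_; _≤?_ to _≤ᶠ?_)
open import Data.Vec as V using (Vec; []; _∷_)
open import Data.List as L using (List; []; _∷_; allFin; upTo; length; cartesianProduct)
open import Data.Bool using (Bool; true; false; if_then_else_; _∧_)
open import Data.Bool.Properties using () renaming (_≟_ to _≟ᵇ_)
open import Data.Maybe as M using (Maybe; just; nothing)
open import Data.Maybe.Properties using () renaming (≡-dec to ≡-decᴹ)
open import Data.Product using (Σ; ∃; _×_; _,_; proj₁; proj₂)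
open import Data.Sum using (_⊎_)
open import Data.Unit using (⊤; tt)
open import Relation.Nullary using (Dec; yes; no; ¬_; does)
open import Relation.Nullary.Decidable using (map′; _×-dec_; _→-dec_; _⊎-dec_; ¬?)
open import Relation.Binary.PropositionalEquality using (_≡_; _≢_; refl)
open import Algebra.Bundles using (CommutativeRing)

vecs : ∀ {a} {A : Set a} → List A → (k : ℕ) → List (Vec A k)
vecs xs zero    = [] ∷ []
vecs xs (suc k) = L.concatMap (λ x → L.map (x ∷_) (vecs xs k)) xs

bools : List Bool
bools = true ∷ false ∷ []

maybes : ∀ {a} {A : Set a} → List A → List (Maybe A)
maybes xs = nothing ∷ L.map just xs

allBools? : ∀ k {p} {P : Vec Bool k → Set p} → (∀ v → Dec (P v)) → Dec (∀ v → P v)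
allBools? zero    P? = map′ (λ p → λ { [] → p }) (λ f → f []) (P? [])
allBools? (suc k) P? =
  map′ (λ tf → λ { (true ∷ v) → proj₁ tf v ; (false ∷ v) → proj₂ tf v })
       (λ g → (λ v → g (true ∷ v)) , (λ v → g (false ∷ v)))
       (allBools? k (λ v → P? (true ∷ v)) ×-dec allBools? k (λ v → P? (false ∷ v)))

viaJust? : ∀ {A : Set} (mb : Maybe A) {Q : A → Set} → (∀ a → Dec (Q a)) →
           Dec (∃ λ a → mb ≡ just a × Q a)
viaJust? nothing  Q? = no λ { (_ , () , _) }
viaJust? (just a) Q? = map′ (λ q → a , refl , q) (λ { (_ , refl , q) → q }) (Q? a)

forJust? : ∀ {A : Set} (mb : Maybe A) {Q : A → Set} → (∀ a → Dec (Q a)) →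
           Dec (∀ a → mb ≡ just a → Q a)
forJust? nothing  Q? = yes λ _ ()
forJust? (just a) Q? = map′ (λ q → λ { _ refl → q }) (λ f → f a refl) (Q? a)

ExactlyOne : ∀ {n} → (Fin n → Set) → Set
ExactlyOne {n} P = ∃ λ (v : Fin n) → P v × (∀ w → P w → v ≡ w)

exactlyOne? : ∀ {n} {P : Fin n → Set} → (∀ v → Dec (P v)) → Dec (ExactlyOne P)
exactlyOne? P? = any? (λ v → P? v ×-dec all? (λ w → P? w →-dec (v ≟ᶠ w)))

next : ∀ {k} → Fin (suc k) → Fin (suc k)
next {k} j with suc (toℕ j) ℕ.<? suc k
... | yes p = fromℕ< p
... | no _  = zero

-- V = Fin n (linearly ordered by the order of Fin n); the hyperedge set A is
-- given by an injective family E : Fin m → Fin 4 → Fin n, E a i = (i+1)-th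
-- vertex of hyperedge a (distinctness of vertices / of hyperedges are
-- hypotheses of the theorem).

-- Position of a connector / circuit data:
--   S : Vec Bool m                               a set of hyperedges
--   C : Vec (Maybe (Vec (Fin m) 4)) n            a set of connectors, stored by
--       their vertex: C[v] = just (h1,h2,h3,h4) means the connector
--       (h1,h2,h3,h4,v) belongs to C.  (Condition (4): each vertex lies in at
--       most one connector, is thereby built into the representation.)
Circ : ℕ → ℕ → Set
Circ n m = Vec Bool m × Vec (Maybe (Vec (Fin m) 4)) n

-- the colours: white = 0, red = 1, green = 2 (positions 1,2,3); blue = 3.
blue : Fin 4
blue = suc (suc (suc zero))

colours : List (Fin 4)
colours = zero ∷ suc zero ∷ suc (suc zero) ∷ []

module _ {n m : ℕ} (E : Fin m → Fin 4 → Fin n) where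

  InS : Vec Bool m → Fin m → Set
  InS S h = V.lookup S h ≡ true

  inS? : ∀ S h → Dec (InS S h)
  inS? S h = V.lookup S h ≟ᵇ true

  Conn : Vec (Maybe (Vec (Fin m) 4)) n → Fin n → Vec (Fin m) 4 → Set
  Conn C v t = V.lookup C v ≡ just t

  LiesIn : Fin n → Vec (Maybe (Vec (Fin m) 4)) n → Set
  LiesIn v C = ∃ λ t → Conn C v t × ⊤

  liesIn? : ∀ v C → Dec (LiesIn v C)
  liesIn? v C = viaJust? (V.lookup C v) (λ _ → yes tt)

  IsConnector : Vec (Fin m) 4 → Fin n → Set
  IsConnector t v = ∀ i → E (V.lookup t i) i ≡ v

  isConnector? : ∀ t v → Dec (IsConnector t v)
  isConnector? t v = all? (λ i → E (V.lookup t i) i ≟ᶠ v)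

  -- O(S) is weakly connected: it is nonempty, and every set of its nodes
  -- (X ⊆ hyperedge-vertices v(h), Y ⊆ V) that is closed under the arcs of
  -- O(S) (arcs join v(h) with the vertices of h) contains all or none of
  -- the nodes of O(S).
  Closed : Vec Bool m → Vec Bool m → Vec Bool n → Set
  Closed S X Y = ∀ h → InS S h → ∀ i → V.lookup X h ≡ V.lookup Y (E h i)

  AllNodes : Bool → Vec Bool m → Vec Bool m → Vec Bool n → Set
  AllNodes b S X Y = ∀ h → InS S h → V.lookup X h ≡ b × (∀ i → V.lookup Y (E h i) ≡ b)

  WeaklyConnected : Vec Bool m → Set
  WeaklyConnected S =
    (∃ λ h → InS S h) ×
    (∀ X Y → Closed S X Y → AllNodes true S X Y ⊎ AllNodes false S X Y)

  weaklyConnected? : ∀ S → Dec (WeaklyConnected S)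
  weaklyConnected? S =
    any? (inS? S) ×-dec
    allBools? m (λ X → allBools? n (λ Y →
      closed? X Y →-dec (allN? true X Y ⊎-dec allN? false X Y)))
    where
    closed? : ∀ X Y → Dec (Closed S X Y)
    closed? X Y = all? (λ h → inS? S h →-dec all? (λ i → V.lookup X h ≟ᵇ V.lookup Y (E h i)))
    allN? : ∀ b X Y → Dec (AllNodes b S X Y)
    allN? b X Y = all? (λ h → inS? S h →-dec
                    ((V.lookup X h ≟ᵇ b) ×-dec all? (λ i → V.lookup Y (E h i) ≟ᵇ b)))

  IsCircuit : Circ n m → Set
  IsCircuit (S , C) =
    (∀ v t → Conn C v t → IsConnector t v) ×
    (∀ h → InS S h → ∀ i → ExactlyOne (λ v → ∃ λ t → Conn C v t × V.lookup t i ≡ h)) ×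
    (∀ v t → Conn C v t → ∀ i → InS S (V.lookup t i)) ×
    WeaklyConnected S

  isCircuit? : ∀ c → Dec (IsCircuit c)
  isCircuit? (S , C) =
    all? (λ v → forJust? (V.lookup C v) (λ t → isConnector? t v)) ×-dec
    all? (λ h → inS? S h →-dec all? (λ i →
      exactlyOne? (λ v → viaJust? (V.lookup C v) (λ t → V.lookup t i ≟ᶠ h)))) ×-dec
    all? (λ v → forJust? (V.lookup C v) (λ t → all? (λ i → inS? S (V.lookup t i)))) ×-dec
    weaklyConnected? S

  -- In the connector digraph of (S , C) the arcs are
  --   v(t[i]) → c   of colour i (white/red/green) for i = 0,1,2, and
  --   c → v(t[3])   blue,
  -- for each connector c = (t[0],..,t[3],v) of C.  A directed cycle
  -- alternating between blue arcs and arcs of colour col is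
  --   c_0 →blue v(h_0) →col c_1 →blue v(h_1) →col … c_k →blue v(h_k) →col c_0
  -- with all nodes distinct; connectors are identified with their vertices,
  -- so such a cycle is recorded by the vector (v_0,…,v_k) of the vertices of
  -- c_0,…,c_k, rotated so that v_0 is the least one (each cycle is thus
  -- represented exactly once).  It has |z| = 2(k+1) arcs.
  CycleRep : Set
  CycleRep = Σ ℕ λ k → Vec (Fin n) (suc k)

  allCycleReps : List CycleRep
  allCycleReps = L.concatMap (λ k → L.map (k ,_) (vecs (allFin n) (suc k))) (upTo n)

  arcCount : CycleRep → ℕ
  arcCount (k , _) = 2 ℕ.* suc k

  blueOf : Vec (Maybe (Vec (Fin m) 4)) n → Fin n → Maybe (Fin m)
  blueOf C v = M.map (λ t → V.lookup t blue) (V.lookup C v)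

  IsConnectorCycle : Fin 4 → Circ n m → CycleRep → Set
  IsConnectorCycle col (S , C) (k , zs) =
    (∀ j → ∃ λ t → Conn C (V.lookup zs j) t ×
             (InS S (V.lookup t blue) ×
              (∃ λ t' → Conn C (V.lookup zs (next j)) t' × V.lookup t' col ≡ V.lookup t blue))) ×
    (∀ j j' → V.lookup zs j ≡ V.lookup zs j' → j ≡ j') ×
    (∀ j j' → blueOf C (V.lookup zs j) ≡ blueOf C (V.lookup zs j') → j ≡ j') ×
    (∀ j → V.lookup zs zero F.≤ V.lookup zs j)

  isConnectorCycle? : ∀ col c z → Dec (IsConnectorCycle col c z)
  isConnectorCycle? col (S , C) (k , zs) =
    all? (λ j → viaJust? (V.lookup C (V.lookup zs j)) (λ t →
      inS? S (V.lookup t blue) ×-dec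
      viaJust? (V.lookup C (V.lookup zs (next j))) (λ t' → V.lookup t' col ≟ᶠ V.lookup t blue))) ×-dec
    all? (λ j → all? (λ j' → (V.lookup zs j ≟ᶠ V.lookup zs j') →-dec (j ≟ᶠ j'))) ×-dec
    all? (λ j → all? (λ j' →
      ≡-decᴹ _≟ᶠ_ (blueOf C (V.lookup zs j)) (blueOf C (V.lookup zs j')) →-dec (j ≟ᶠ j'))) ×-dec
    all? (λ j → V.lookup zs zero ≤ᶠ? V.lookup zs j)

  -- Sets P of 4-circuits: subsets of the (finite) list of all pairs (S , C).
  allCircs : List (Circ n m)
  allCircs = cartesianProduct (vecs bools m) (vecs (maybes (vecs (allFin m) 4)) n)

  CircSet : Set
  CircSet = Vec Bool (length allCircs)

  Member : CircSet → Fin (length allCircs) → Set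
  Member P j = V.lookup P j ≡ true

  circ : Fin (length allCircs) → Circ n m
  circ = L.lookup allCircs

  connsOf : Fin (length allCircs) → Vec (Maybe (Vec (Fin m) 4)) n
  connsOf j = proj₂ (circ j)

  IsCircuitPartition : CircSet → Set
  IsCircuitPartition P =
    (∀ j → Member P j → IsCircuit (circ j)) ×
    (∀ j j' → Member P j → Member P j' → j ≢ j' →
       ∀ v → ¬ (LiesIn v (connsOf j) × LiesIn v (connsOf j'))) ×
    (∀ v → ∃ λ j → Member P j × LiesIn v (connsOf j))

  isCircuitPartition? : ∀ P → Dec (IsCircuitPartition P)
  isCircuitPartition? P =
    all? (λ j → (V.lookup P j ≟ᵇ true) →-dec isCircuit? (circ j)) ×-dec
    all? (λ j → all? (λ j' → (V.lookup P j ≟ᵇ true) →-dec ((V.lookup P j' ≟ᵇ true) →-dec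
      (¬? (j ≟ᶠ j') →-dec all? (λ v → ¬? (liesIn? v (connsOf j) ×-dec liesIn? v (connsOf j'))))))) ×-dec
    all? (λ v → any? (λ j → (V.lookup P j ≟ᵇ true) ×-dec liesIn? v (connsOf j)))

module _ {c ℓ : Level} (R : CommutativeRing c ℓ) where
  open CommutativeRing R

  sumL : ∀ {a} {A : Set a} → List A → (A → Carrier) → Carrier
  sumL xs f = L.foldr (λ x r → f x + r) 0# xs

  prodL : ∀ {a} {A : Set a} → List A → (A → Carrier) → Carrier
  prodL xs f = L.foldr (λ x r → f x * r) 1# xs

  sumIf : ∀ {a p} {A : Set a} {Q : A → Set p} → List A → (∀ x → Dec (Q x)) → (A → Carrier) → Carrier
  sumIf xs Q? f = sumL xs (λ x → if does (Q? x) then f x else 0#)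

  prodIf : ∀ {a p} {A : Set a} {Q : A → Set p} → List A → (∀ x → Dec (Q x)) → (A → Carrier) → Carrier
  prodIf xs Q? f = prodL xs (λ x → if does (Q? x) then f x else 1#)

  negOnePow : ℕ → Carrier
  negOnePow zero    = 1#
  negOnePow (suc k) = (- 1#) * negOnePow k

  IsPerm : ∀ {n} → Vec (Fin n) n → Set
  IsPerm σ = ∀ i j → V.lookup σ i ≡ V.lookup σ j → i ≡ j

  isPerm? : ∀ {n} (σ : Vec (Fin n) n) → Dec (IsPerm σ)
  isPerm? σ = all? (λ i → all? (λ j → (V.lookup σ i ≟ᶠ V.lookup σ j) →-dec (i ≟ᶠ j)))

  sign : ∀ {n} → Vec (Fin n) n → Carrier
  sign {n} σ = prodL (allFin n) (λ i → prodL (allFin n) (λ j →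
    if does (i <ᶠ? j) ∧ does (V.lookup σ j <ᶠ? V.lookup σ i) then - 1# else 1#))

  det : ∀ {n} → (Fin n → Fin n → Fin n → Fin n → Carrier) → Carrier
  det {n} M =
    sumIf perms isPerm? λ α₁ → sumIf perms isPerm? λ α₂ → sumIf perms isPerm? λ α₃ →
      sign α₁ * sign α₂ * sign α₃ *
      prodL (allFin n) (λ i → M (V.lookup α₁ i) (V.lookup α₂ i) (V.lookup α₃ i) i)
    where perms = vecs (allFin n) n

  adjacency4 : ∀ {n m} → (Fin m → Fin 4 → Fin n) → (Fin m → Carrier) →
               Fin n → Fin n → Fin n → Fin n → Carrier
  adjacency4 {n} {m} E x i₁ i₂ i₃ i₄ =
    sumIf (allFin m) (λ a → all? (λ j → E a j ≟ᶠ V.lookup (i₁ ∷ i₂ ∷ i₃ ∷ i₄ ∷ []) j)) x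

  circuitSign : ∀ {n m} (E : Fin m → Fin 4 → Fin n) → Circ n m → Carrier
  circuitSign E c = prodL colours (λ col →
    prodIf (allCycleReps E) (isConnectorCycle? E col c) (λ z →
      negOnePow (⌊ arcCount E z /2⌋ ∸ 1)))

  circuitExpansion : ∀ {n m} (E : Fin m → Fin 4 → Fin n) → (Fin m → Carrier) → Carrier
  circuitExpansion {n} {m} E x =
    sumIf (vecs bools (length (allCircs E))) (isCircuitPartition? E) λ P →
      prodIf (allFin (length (allCircs E))) (λ j → V.lookup P j ≟ᵇ true) λ j →
        circuitSign E (circ E j) *
        prodIf (allFin m) (λ a → V.lookup (proj₁ (circ E j)) a ≟ᵇ true) x

module Submission where

-- A term of det A(D,x) is nonzero only for triples (α₁ , α₂ , α₃) of permutations such that, for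
-- every vertex v, the tuple (α₁ v , α₂ v , α₃ v , v) is a hyperedge h v. Such a triple is the same
-- as a connector system: the connector at v has h (αᵢ⁻¹ v) at position i and h v at the last one.
-- The weak components of O({h v}) with these connectors are vertex-disjoint 4-circuits covering V,
-- and every such set of 4-circuits arises from exactly one connector system. The monomial of the term
-- is the product of the x over the hyperedges of the circuits. The connector cycles of colour i are
-- the cycles of αᵢ, a cycle of length k having 2k arcs, so the product of the circuit signs is
-- sign α₁ · sign α₂ · sign α₃ by the cycle formula sign σ = ∏ (-1)^(length - 1) over the cycles of σ.

open import Defs using (det; adjacency4; circuitExpansion)
open import Data.Nat using (ℕ; zero; suc)
open import Data.Fin using (Fin; zero)
open import Relation.Binary.PropositionalEquality using (_≡_)
open import Algebra.Bundles using (CommutativeRing)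

module BigOperators where

  open import Function using (_∘_)
  open import Algebra.Bundles using (CommutativeMonoid)
  open import Data.List as L using (List; []; _∷_; _++_; map; filter; foldr; cartesianProduct)
  open import Data.List.Membership.Propositional using (_∈_; _∉_)
  open import Data.List.Membership.Propositional.Properties
    using (∈-∃++; ∈-++⁺ʳ; ∈-map⁺; ∈-map⁻; ∈-filter⁺; ∈-filter⁻)
  open import Data.List.Relation.Unary.Any using (here; there)
  open import Data.List.Relation.Unary.All as All using (All; []; _∷_)
  open import Data.List.Relation.Unary.AllPairs using ([]; _∷_)
  open import Data.List.Relation.Unary.Unique.Propositional using (Unique)
  import Data.List.Relation.Unary.Unique.Propositional.Properties as Unique
  import Data.List.Relation.Binary.Permutation.Propositional as ↭
  open ↭ using (_↭_; ↭-sym; ↭-trans; ↭-refl; ↭-prep)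
  open import Data.List.Relation.Binary.Permutation.Propositional.Properties using (shift)
  open import Relation.Binary.PropositionalEquality as ≡ using (_≡_; _≢_)
  open import Relation.Nullary using (Dec; yes; no; ¬_; does)
  open import Relation.Nullary.Decidable using (dec-true; dec-false)
  open import Relation.Unary using (Decidable)
  open import Data.Product using (∃; _×_; _,_; proj₁; proj₂)
  open import Data.Empty using (⊥-elim)
  open import Data.Bool using (Bool; true; false; if_then_else_; _∧_)

  if-yes : ∀ {a p} {A : Set a} {P : Set p} (P? : Dec P) {x y : A} → P → (if does P? then x else y) ≡ x
  if-yes P? p = ≡.cong (if_then _ else _) (dec-true P? p)

  if-no : ∀ {a p} {A : Set a} {P : Set p} (P? : Dec P) {x y : A} → ¬ P → (if does P? then x else y) ≡ y
  if-no P? ¬p = ≡.cong (if_then _ else _) (dec-false P? ¬p)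

  if-∧ : ∀ {a} {A : Set a} b c {u e : A} → (if b then (if c then u else e) else e) ≡ (if b ∧ c then u else e)
  if-∧ true  c = ≡.refl
  if-∧ false c = ≡.refl

  module _ {a} {A : Set a} where

    private
      ∈-remove : ∀ {x z : A} xs {ys} → z ≢ x → z ∈ xs ++ x ∷ ys → z ∈ xs ++ ys
      ∈-remove []       z≢x (here z≡x) = ⊥-elim (z≢x z≡x)
      ∈-remove []       z≢x (there p)  = p
      ∈-remove (_ ∷ xs) z≢x (here p)   = here p
      ∈-remove (_ ∷ xs) z≢x (there p)  = there (∈-remove xs z≢x p)

      ∈-insert : ∀ {x z : A} xs {ys} → z ∈ xs ++ ys → z ∈ xs ++ x ∷ ys
      ∈-insert []       p         = there p
      ∈-insert (_ ∷ xs) (here p)  = here p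
      ∈-insert (_ ∷ xs) (there p) = there (∈-insert xs p)

      All-remove : ∀ {p} {P : A → Set p} {x : A} xs {ys} → All P (xs ++ x ∷ ys) → All P (xs ++ ys)
      All-remove []       (_ ∷ q)  = q
      All-remove (_ ∷ xs) (p ∷ q) = p ∷ All-remove xs q

      Unique-remove : ∀ {x : A} xs {ys} → Unique (xs ++ x ∷ ys) → Unique (xs ++ ys)
      Unique-remove []       (_ ∷ u)  = u
      Unique-remove (_ ∷ xs) (p ∷ u) = All-remove xs p ∷ Unique-remove xs u

      Unique⇒removed∉ : ∀ {x : A} xs {ys} → Unique (xs ++ x ∷ ys) → x ∉ xs ++ ys
      Unique⇒removed∉ []       (x∉ ∷ _) x∈         = All.lookup x∉ x∈ ≡.refl
      Unique⇒removed∉ (_ ∷ xs) (y∉ ∷ _) (here x≡y) = All.lookup y∉ (∈-++⁺ʳ xs (here ≡.refl)) (≡.sym x≡y)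
      Unique⇒removed∉ (_ ∷ xs) (_ ∷ u)  (there x∈) = Unique⇒removed∉ xs u x∈

    Unique-sameElements⇒↭ : ∀ {xs ys : List A} → Unique xs → Unique ys →
                            (∀ {z} → z ∈ xs → z ∈ ys) → (∀ {z} → z ∈ ys → z ∈ xs) → xs ↭ ys
    Unique-sameElements⇒↭ {[]}     {[]}     _ _ _ _ = ↭-refl
    Unique-sameElements⇒↭ {[]}     {_ ∷ _}  _ _ _ ys⊆ with ys⊆ (here ≡.refl)
    ... | ()
    Unique-sameElements⇒↭ {x ∷ xs} {ys} (x∉ ∷ uxs) uys xs⊆ ys⊆ with ∈-∃++ (xs⊆ (here ≡.refl))
    ... | as , bs , ≡.refl =
      ↭-trans (↭-prep x (Unique-sameElements⇒↭ uxs (Unique-remove as uys) xs⊆′ ys⊆′)) (↭-sym (shift x as bs))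
      where
      xs⊆′ : ∀ {z} → z ∈ xs → z ∈ as ++ bs
      xs⊆′ z∈ = ∈-remove as (λ z≡x → All.lookup x∉ z∈ (≡.sym z≡x)) (xs⊆ (there z∈))
      ys⊆′ : ∀ {z} → z ∈ as ++ bs → z ∈ xs
      ys⊆′ z∈ with ys⊆ (∈-insert as z∈)
      ... | here ≡.refl = ⊥-elim (Unique⇒removed∉ as uys z∈)
      ... | there z∈xs  = z∈xs

    map⁺-Unique : ∀ {b} {B : Set b} (f : A → B) {xs : List A} →
                  (∀ {x y} → x ∈ xs → y ∈ xs → f x ≡ f y → x ≡ y) → Unique xs → Unique (map f xs)
    map⁺-Unique f {[]}     _   []        = []
    map⁺-Unique f {x ∷ xs} inj (x∉ ∷ u) =
      All.tabulate (λ z∈ fx≡z → let (y , y∈ , z≡fy) = ∈-map⁻ f z∈ in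
                     All.lookup x∉ y∈ (inj (here ≡.refl) (there y∈) (≡.trans fx≡z z≡fy)))
      ∷ map⁺-Unique f (λ x∈ y∈ → inj (there x∈) (there y∈)) u

  module Big {c ℓ} (M : CommutativeMonoid c ℓ) where
    open CommutativeMonoid M renaming (Carrier to C)
    open import Relation.Binary.Reasoning.Setoid setoid
    open import Algebra.Properties.CommutativeSemigroup commutativeSemigroup using (interchange; x∙yz≈y∙xz)

    big : ∀ {a} {A : Set a} → List A → (A → C) → C
    big xs f = foldr (λ x r → f x ∙ r) ε xs

    module _ {a} {A : Set a} where
      big-cong : ∀ (xs : List A) {f g} → (∀ {x} → x ∈ xs → f x ≈ g x) → big xs f ≈ big xs g
      big-cong []       _ = refl
      big-cong (x ∷ xs) h = ∙-cong (h (here ≡.refl)) (big-cong xs (h ∘ there))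

      big-cong′ : ∀ (xs : List A) {f g} → (∀ x → f x ≈ g x) → big xs f ≈ big xs g
      big-cong′ xs h = big-cong xs (λ {x} _ → h x)

      big-++ : ∀ (xs ys : List A) f → big (xs ++ ys) f ≈ big xs f ∙ big ys f
      big-++ []       ys f = sym (identityˡ _)
      big-++ (x ∷ xs) ys f = trans (∙-congˡ (big-++ xs ys f)) (sym (assoc _ _ _))

      big-ε : ∀ (xs : List A) {f} → (∀ {x} → x ∈ xs → f x ≈ ε) → big xs f ≈ ε
      big-ε []       _ = refl
      big-ε (x ∷ xs) h = trans (∙-cong (h (here ≡.refl)) (big-ε xs (h ∘ there))) (identityˡ ε)

      big-distrib : ∀ (xs : List A) f g → big xs (λ x → f x ∙ g x) ≈ big xs f ∙ big xs g
      big-distrib []       f g = sym (identityˡ ε)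
      big-distrib (x ∷ xs) f g = trans (∙-congˡ (big-distrib xs f g)) (interchange _ _ _ _)

      big-↭ : ∀ {xs ys : List A} f → xs ↭ ys → big xs f ≈ big ys f
      big-↭ f ↭.refl           = refl
      big-↭ f (↭.prep x p)     = ∙-congˡ (big-↭ f p)
      big-↭ f (↭.swap x y p)   = trans (∙-congˡ (∙-congˡ (big-↭ f p))) (x∙yz≈y∙xz _ _ _)
      big-↭ f (↭.trans p q)    = trans (big-↭ f p) (big-↭ f q)

      big-filter : ∀ {p} {P : A → Set p} (P? : Decidable P) (xs : List A) f →
                   (∀ {x} → x ∈ xs → ¬ P x → f x ≈ ε) → big xs f ≈ big (filter P? xs) f
      big-filter P? []       f h = refl
      big-filter P? (x ∷ xs) f h with P? x
      ... | yes _  = ∙-congˡ (big-filter P? xs f (h ∘ there))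
      ... | no ¬px = trans (∙-cong (h (here ≡.refl) ¬px) (big-filter P? xs f (h ∘ there))) (identityˡ _)

      big-single : ∀ (xs : List A) {f x₀} → Unique xs → x₀ ∈ xs →
                   (∀ {x} → x ∈ xs → x ≢ x₀ → f x ≈ ε) → big xs f ≈ f x₀
      big-single (x ∷ xs) (x∉ ∷ u) (here ≡.refl) h =
        trans (∙-congˡ (big-ε xs (λ y∈ → h (there y∈) (λ y≡x → All.lookup x∉ y∈ (≡.sym y≡x))))) (identityʳ _)
      big-single (x ∷ xs) (x∉ ∷ u) (there x₀∈) h =
        trans (∙-congʳ (h (here ≡.refl) (All.lookup x∉ x₀∈))) (trans (identityˡ _) (big-single xs u x₀∈ (h ∘ there)))

    if-big : ∀ {a} {A : Set a} b (xs : List A) f → (if b then big xs f else ε) ≈ big xs (λ x → if b then f x else ε)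
    if-big true  xs f = refl
    if-big false xs f = sym (big-ε xs (λ _ → refl))

    if-∙ : ∀ b (u v : C) → (if b then u ∙ v else ε) ≈ (if b then u else ε) ∙ (if b then v else ε)
    if-∙ true  u v = refl
    if-∙ false u v = sym (identityˡ ε)

    big-map : ∀ {a b} {A : Set a} {B : Set b} (φ : A → B) (xs : List A) f → big (map φ xs) f ≈ big xs (f ∘ φ)
    big-map φ []       f = refl
    big-map φ (x ∷ xs) f = ∙-congˡ (big-map φ xs f)

    big-comm : ∀ {a b} {A : Set a} {B : Set b} (xs : List A) (ys : List B) (f : A → B → C) →
               big xs (λ x → big ys (f x)) ≈ big ys (λ y → big xs (λ x → f x y))
    big-comm []       ys f = sym (big-ε ys (λ _ → refl))
    big-comm (x ∷ xs) ys f = trans (∙-congˡ (big-comm xs ys f)) (sym (big-distrib ys (f x) _))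

    big-cartesianProduct : ∀ {a b} {A : Set a} {B : Set b} (xs : List A) (ys : List B) (h : A × B → C) →
                           big (cartesianProduct xs ys) h ≈ big xs (λ x → big ys (λ y → h (x , y)))
    big-cartesianProduct []       ys h = refl
    big-cartesianProduct (x ∷ xs) ys h =
      trans (big-++ (map (x ,_) ys) _ h) (∙-cong (big-map (x ,_) ys h) (big-cartesianProduct xs ys h))

    -- Change of variables: φ and ψ are mutually inverse bijections between the supports P of f and Q of g.
    big-reindex : ∀ {a b p q} {A : Set a} {B : Set b} {P : A → Set p} {Q : B → Set q}
      (xs : List A) (ys : List B) → Unique xs → Unique ys →
      (P? : Decidable P) (Q? : Decidable Q) (f : A → C) (g : B → C) (φ : A → B) (ψ : B → A) →
      (∀ {x} → x ∈ xs → ¬ P x → f x ≈ ε) →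
      (∀ {y} → y ∈ ys → ¬ Q y → g y ≈ ε) →
      (∀ {x} → x ∈ xs → P x → φ x ∈ ys × Q (φ x) × ψ (φ x) ≡ x × g (φ x) ≈ f x) →
      (∀ {y} → y ∈ ys → Q y → ψ y ∈ xs × P (ψ y) × φ (ψ y) ≡ y) →
      big xs f ≈ big ys g
    big-reindex xs ys uxs uys P? Q? f g φ ψ f-supp g-supp to from = begin
        big xs f                        ≈⟨ big-filter P? xs f f-supp ⟩
        big (filter P? xs) f            ≈⟨ big-cong (filter P? xs) (λ x∈ → let (x∈xs , px) = ∈-filter⁻ P? x∈ in
                                             sym (proj₂ (proj₂ (proj₂ (to x∈xs px))))) ⟩
        big (filter P? xs) (g ∘ φ)      ≈⟨ sym (big-map φ (filter P? xs) g) ⟩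
        big (map φ (filter P? xs)) g    ≈⟨ big-↭ g (Unique-sameElements⇒↭ (map⁺-Unique φ φ-inj (Unique.filter⁺ P? uxs))
                                                                     (Unique.filter⁺ Q? uys) image⊆ ⊆image) ⟩
        big (filter Q? ys) g            ≈⟨ sym (big-filter Q? ys g g-supp) ⟩
        big ys g                        ∎
      where
      φ-inj : ∀ {x y} → x ∈ filter P? xs → y ∈ filter P? xs → φ x ≡ φ y → x ≡ y
      φ-inj x∈ y∈ φx≡φy =
        let (x∈xs , px) = ∈-filter⁻ P? x∈ ; (y∈xs , py) = ∈-filter⁻ P? y∈ in
        ≡.trans (≡.sym (proj₁ (proj₂ (proj₂ (to x∈xs px)))))
          (≡.trans (≡.cong ψ φx≡φy) (proj₁ (proj₂ (proj₂ (to y∈xs py)))))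
      image⊆ : ∀ {z} → z ∈ map φ (filter P? xs) → z ∈ filter Q? ys
      image⊆ z∈ with ∈-map⁻ φ z∈
      ... | x , x∈ , ≡.refl = let (x∈xs , px) = ∈-filter⁻ P? x∈ ; (φx∈ , qφx , _) = to x∈xs px in ∈-filter⁺ Q? φx∈ qφx
      ⊆image : ∀ {z} → z ∈ filter Q? ys → z ∈ map φ (filter P? xs)
      ⊆image {z} z∈ = let (z∈ys , qz) = ∈-filter⁻ Q? z∈ ; (ψz∈ , pψz , φψz≡z) = from z∈ys qz in
        ≡.subst (_∈ map φ (filter P? xs)) φψz≡z (∈-map⁺ φ (∈-filter⁺ P? ψz∈ pψz))

    -- The blocks {x ∣ R j x}, j ∈ js, partition {x ∣ T x}.
    big-regroup : ∀ {a b r t} {J : Set a} {A : Set b} {R : J → A → Set r} {T : A → Set t}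
      (js : List J) (xs : List A) → Unique js → (R? : ∀ j x → Dec (R j x)) (T? : Decidable T) (w : A → C) →
      (∀ {x} → x ∈ xs → T x → ∃ λ j → j ∈ js × R j x × (∀ {j′} → j′ ∈ js → R j′ x → j′ ≡ j)) →
      (∀ {x} → x ∈ xs → ¬ T x → ∀ {j} → j ∈ js → ¬ R j x) →
      big js (λ j → big xs (λ x → if does (R? j x) then w x else ε)) ≈ big xs (λ x → if does (T? x) then w x else ε)
    big-regroup js xs ujs R? T? w inBlock noBlock = trans (big-comm js xs _) (big-cong xs pointwise)
      where
      pointwise : ∀ {x} → x ∈ xs → big js (λ j → if does (R? j x) then w x else ε) ≈ (if does (T? x) then w x else ε)
      pointwise {x} x∈ with T? x
      ... | yes tx = let (j , j∈ , rjx , unique) = inBlock x∈ tx in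
        trans (big-single js ujs j∈ (λ {j′} j′∈ j′≢j → reflexive (if-no (R? j′ x) (j′≢j ∘ unique j′∈))))
              (reflexive (if-yes (R? j x) rjx))
      ... | no ¬tx = big-ε js (λ j∈ → reflexive (if-no (R? _ x) (noBlock x∈ ¬tx j∈)))

    module _ {a} {A : Set a} (_≟_ : (x y : A) → Dec (x ≡ y)) where
      except : A → (A → C) → A → C
      except x₀ f x = if does (x ≟ x₀) then ε else f x

      big-extract : ∀ (xs : List A) {f x₀} → Unique xs → x₀ ∈ xs → big xs f ≈ f x₀ ∙ big xs (except x₀ f)
      big-extract (x ∷ xs) {f} (x∉ ∷ u) (here ≡.refl) =
        ∙-congˡ (trans (big-cong xs λ {y} y∈ → reflexive (≡.sym (if-no (y ≟ x) (λ y≡x → All.lookup x∉ y∈ (≡.sym y≡x)))))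
                       (sym (trans (∙-congʳ (reflexive (if-yes (x ≟ x) ≡.refl))) (identityˡ _))))
      big-extract (x ∷ xs) {f} {x₀} (x∉ ∷ u) (there x₀∈) = begin
        f x ∙ big xs f                                  ≈⟨ ∙-congˡ (big-extract xs u x₀∈) ⟩
        f x ∙ (f x₀ ∙ big xs (except x₀ f))             ≈⟨ x∙yz≈y∙xz _ _ _ ⟩
        f x₀ ∙ (f x ∙ big xs (except x₀ f))             ≈⟨ ∙-congˡ (∙-congʳ (reflexive (≡.sym (if-no (x ≟ x₀) (All.lookup x∉ x₀∈))))) ⟩
        f x₀ ∙ (except x₀ f x ∙ big xs (except x₀ f))   ∎

module PermutationSign where

  open import Function using (_∘_; _⇔_; mk⇔)
  open import Function.Definitions using (Injective)
  open import Algebra.Bundles using (CommutativeRing)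
  open import Data.Nat as ℕ using (ℕ; zero; suc; _∸_)
  import Data.Nat.Properties as ℕ
  open import Data.Fin as F using (Fin; zero; suc; toℕ; fromℕ<; punchOut)
  open import Data.Fin.Properties
    using (<-cmp; _≟_; _<?_; toℕ-injective; any?; punchOut-injective; injective⇒≤; toℕ-fromℕ<; toℕ<n)
  open import Data.Fin.Permutation.Components using (transpose; transpose-inverse)
  open import Relation.Binary.Definitions using (tri<; tri≈; tri>)
  open import Data.List using (List; allFin; cartesianProduct)
  open import Data.List.Membership.Propositional using (_∈_)
  open import Data.List.Membership.Propositional.Properties using (∈-allFin; ∈-cartesianProduct⁺)
  import Data.List.Relation.Unary.Unique.Propositional.Properties as Unique
  open import Relation.Binary.PropositionalEquality as ≡ using (_≡_; _≢_; refl; _≗_)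
  open import Relation.Nullary using (Dec; yes; no; ¬_; does)
  open import Relation.Nullary.Decidable using (does-⇔; dec-true; dec-false)
  open import Data.Product using (∃; _×_; _,_; proj₁; proj₂; uncurry)
  open import Data.Product.Properties using () renaming (≡-dec to ×-≡-dec)
  open import Data.Empty using (⊥-elim)
  open import Data.Unit using (tt)
  open import Data.Bool using (if_then_else_; _∧_)
  open BigOperators

  injective⇒surjective : ∀ {n} {f : Fin n → Fin n} → Injective _≡_ _≡_ f → ∀ y → ∃ λ x → f x ≡ y
  injective⇒surjective {suc n} {f} f-inj y with any? (λ x → f x ≟ y)
  ... | yes hit = hit
  ... | no miss = ⊥-elim (ℕ.<-irrefl refl (injective⇒≤ g-inj))
    where
    g : Fin (suc n) → Fin n
    g x = punchOut {i = y} {j = f x} (λ y≡fx → miss (x , ≡.sym y≡fx))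
    g-inj : Injective _≡_ _≡_ g
    g-inj {x} {x′} eq = f-inj (punchOut-injective (λ y≡fx → miss (x , ≡.sym y≡fx)) (λ y≡fx′ → miss (x′ , ≡.sym y≡fx′)) eq)

  module _ {n : ℕ} where

    transpose-matchˡ : ∀ (a b : Fin n) → transpose a b a ≡ b
    transpose-matchˡ a b with a ≟ a
    ... | yes _ = refl
    ... | no a≢a = ⊥-elim (a≢a refl)

    transpose-matchʳ : ∀ (a b : Fin n) → transpose a b b ≡ a
    transpose-matchʳ a b with b ≟ a
    ... | yes b≡a = b≡a
    ... | no _ with b ≟ b
    ...   | yes _ = refl
    ...   | no b≢b = ⊥-elim (b≢b refl)

    transpose-mismatch : ∀ (a b x : Fin n) → x ≢ a → x ≢ b → transpose a b x ≡ x
    transpose-mismatch a b x x≢a x≢b with x ≟ a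
    ... | yes x≡a = ⊥-elim (x≢a x≡a)
    ... | no _ with x ≟ b
    ...   | yes x≡b = ⊥-elim (x≢b x≡b)
    ...   | no _ = refl

    data Position (a b x : Fin n) : Set where
      atˡ  : x ≡ a → Position a b x
      atʳ  : x ≢ a → x ≡ b → Position a b x
      away : x ≢ a → x ≢ b → Position a b x

    position : ∀ a b x → Position a b x
    position a b x with x ≟ a
    ... | yes x≡a = atˡ x≡a
    ... | no x≢a with x ≟ b
    ...   | yes x≡b = atʳ x≢a x≡b
    ...   | no x≢b = away x≢a x≢b

    transpose-involutive : ∀ (a b x : Fin n) → transpose a b (transpose a b x) ≡ x
    transpose-involutive a b x with position a b x
    ... | atˡ refl     = ≡.trans (≡.cong (transpose x b) (transpose-matchˡ x b)) (transpose-matchʳ x b)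
    ... | atʳ _ refl   = ≡.trans (≡.cong (transpose a x) (transpose-matchʳ a x)) (transpose-matchˡ a x)
    ... | away x≢a x≢b = ≡.trans (≡.cong (transpose a b) (transpose-mismatch a b x x≢a x≢b)) (transpose-mismatch a b x x≢a x≢b)

    transpose-injective : ∀ (a b : Fin n) → Injective _≡_ _≡_ (transpose a b)
    transpose-injective a b {x} {y} eq =
      ≡.trans (≡.sym (transpose-involutive a b x)) (≡.trans (≡.cong (transpose a b) eq) (transpose-involutive a b y))

    transpose-comm : ∀ (a b : Fin n) → transpose a b ≗ transpose b a
    transpose-comm a b x = ≡.trans (≡.cong (transpose a b) (≡.sym (transpose-involutive b a x))) (transpose-inverse a b)


    transpose-conjugate : ∀ (a b c x : Fin n) → a ≢ b → a ≢ c → c ≢ b →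
                          transpose a b x ≡ transpose a c (transpose c b (transpose a c x))
    transpose-conjugate a b c x a≢b a≢c c≢b with position a c x
    ... | atˡ refl = ≡.trans (transpose-matchˡ x b) (≡.sym (≡.trans (≡.cong (transpose x c ∘ transpose c b) (transpose-matchˡ x c))
                       (≡.trans (≡.cong (transpose x c) (transpose-matchˡ c b)) (transpose-mismatch x c b (a≢b ∘ ≡.sym) (c≢b ∘ ≡.sym)))))
    ... | atʳ x≢a refl = ≡.trans (transpose-mismatch a b x x≢a c≢b) (≡.sym (≡.trans (≡.cong (transpose a x ∘ transpose x b) (transpose-matchʳ a x))
                       (≡.trans (≡.cong (transpose a x) (transpose-mismatch x b a a≢c a≢b)) (transpose-matchˡ a x))))
    ... | away x≢a x≢c with x ≟ b
    ...   | yes refl = ≡.trans (transpose-matchʳ a x) (≡.sym (≡.trans (≡.cong (transpose a c ∘ transpose c x) (transpose-mismatch a c x x≢a x≢c))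
                         (≡.trans (≡.cong (transpose a c) (transpose-matchʳ c x)) (transpose-matchʳ a c))))
    ...   | no x≢b = ≡.trans (transpose-mismatch a b x x≢a x≢b) (≡.sym (≡.trans (≡.cong (transpose a c ∘ transpose c b) (transpose-mismatch a c x x≢a x≢c))
                       (≡.trans (≡.cong (transpose a c) (transpose-mismatch c b x x≢c x≢b)) (transpose-mismatch a c x x≢a x≢c))))

    module AdjacentTransposition (a b : Fin n) (b≡1+a : toℕ b ≡ suc (toℕ a)) where
      private
        τ = transpose a b
        a<b : a F.< b
        a<b = ≡.subst (toℕ a ℕ.<_) (≡.sym b≡1+a) (ℕ.n<1+n _)
        above : ∀ {x : Fin n} → x ≢ b → a F.< x → b F.< x
        above x≢b a<x = ℕ.≤∧≢⇒< (≡.subst (ℕ._≤ _) (≡.sym b≡1+a) a<x) (λ eq → x≢b (toℕ-injective (≡.sym eq)))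
        below : ∀ {x : Fin n} → x ≢ a → x F.< b → x F.< a
        below x≢a x<b = ℕ.≤∧≢⇒< (ℕ.≤-pred (≡.subst (_ ℕ.<_) b≡1+a x<b)) (x≢a ∘ toℕ-injective)
        <-irrefl : ∀ {x : Fin n} → ¬ x F.< x
        <-irrefl = ℕ.<-irrefl refl

      preserves-< : ∀ i j → (i , j) ≢ (a , b) → (i , j) ≢ (b , a) → τ i F.< τ j ⇔ i F.< j
      preserves-< i j ≢ab ≢ba with position a b i | position a b j
      ... | atˡ refl | atˡ refl = mk⇔ (⊥-elim ∘ <-irrefl) (⊥-elim ∘ <-irrefl)
      ... | atˡ refl | atʳ _ refl = ⊥-elim (≢ab refl)
      ... | atˡ refl | away j≢a j≢b =
        mk⇔ (λ lt → ℕ.<-trans a<b (≡.subst₂ F._<_ (transpose-matchˡ i b) (transpose-mismatch i b j j≢a j≢b) lt))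
            (λ lt → ≡.subst₂ F._<_ (≡.sym (transpose-matchˡ i b)) (≡.sym (transpose-mismatch i b j j≢a j≢b)) (above j≢b lt))
      ... | atʳ _ refl | atˡ refl = ⊥-elim (≢ba refl)
      ... | atʳ _ refl | atʳ _ refl = mk⇔ (⊥-elim ∘ <-irrefl) (⊥-elim ∘ <-irrefl)
      ... | atʳ _ refl | away j≢a j≢b =
        mk⇔ (λ lt → above j≢b (≡.subst₂ F._<_ (transpose-matchʳ a i) (transpose-mismatch a i j j≢a j≢b) lt))
            (λ lt → ≡.subst₂ F._<_ (≡.sym (transpose-matchʳ a i)) (≡.sym (transpose-mismatch a i j j≢a j≢b)) (ℕ.<-trans a<b lt))
      ... | away i≢a i≢b | atˡ refl =
        mk⇔ (λ lt → below i≢a (≡.subst₂ F._<_ (transpose-mismatch j b i i≢a i≢b) (transpose-matchˡ j b) lt))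
            (λ lt → ≡.subst₂ F._<_ (≡.sym (transpose-mismatch j b i i≢a i≢b)) (≡.sym (transpose-matchˡ j b)) (ℕ.<-trans lt a<b))
      ... | away i≢a i≢b | atʳ _ refl =
        mk⇔ (λ lt → ℕ.<-trans (≡.subst₂ F._<_ (transpose-mismatch a j i i≢a i≢b) (transpose-matchʳ a j) lt) a<b)
            (λ lt → ≡.subst₂ F._<_ (≡.sym (transpose-mismatch a j i i≢a i≢b)) (≡.sym (transpose-matchʳ a j)) (below i≢a lt))
      ... | away i≢a i≢b | away j≢a j≢b =
        mk⇔ (≡.subst₂ F._<_ (transpose-mismatch a b i i≢a i≢b) (transpose-mismatch a b j j≢a j≢b))
            (≡.subst₂ F._<_ (≡.sym (transpose-mismatch a b i i≢a i≢b)) (≡.sym (transpose-mismatch a b j j≢a j≢b)))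

  module Sign {c ℓ} (R : CommutativeRing c ℓ) where
    open CommutativeRing R hiding (zero) renaming (refl to ≈-refl)
    open import Algebra.Properties.Ring ring using (-‿involutive; -‿distribˡ-*)
    open Big *-commutativeMonoid using () renaming (big to Π; big-cong′ to Π-cong′; big-reindex to Π-reindex;
      big-cartesianProduct to Π-cartesianProduct; big-extract to Π-extract; except to except)
    open import Relation.Binary.Reasoning.Setoid setoid

    inversionSign : ∀ {n} → (Fin n → Fin n) → Fin n → Fin n → Carrier
    inversionSign f i j = if does (i <? j) ∧ does (f j <? f i) then - 1# else 1#

    sgn : ∀ {n} → (Fin n → Fin n) → Carrier
    sgn {n} f = Π (allFin n) (λ i → Π (allFin n) (λ j → inversionSign f i j))

    sgn-cong : ∀ {n} {f g : Fin n → Fin n} → f ≗ g → sgn f ≈ sgn g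
    sgn-cong f≗g = Π-cong′ (allFin _) λ i → Π-cong′ (allFin _) λ j →
      reflexive (≡.cong₂ (λ u v → if does (i <? j) ∧ does (u <? v) then - 1# else 1#) (f≗g j) (f≗g i))

    private
      pairs : ∀ n → List (Fin n × Fin n)
      pairs n = cartesianProduct (allFin n) (allFin n)

      ∈-pairs : ∀ {n} (p : Fin n × Fin n) → p ∈ pairs n
      ∈-pairs (i , j) = ∈-cartesianProduct⁺ (∈-allFin i) (∈-allFin j)

      _≟ₚ_ : ∀ {n} (p q : Fin n × Fin n) → Dec (p ≡ q)
      _≟ₚ_ = ×-≡-dec _≟_ _≟_

    -- Reindexing the pairs (i , j) by (τ i , τ j), the sign of f ∘ τ becomes a product that
    -- differs from the one defining sgn f only at the two pairs (a , b) and (b , a).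
    private module Adjacent {n} (f : Fin n → Fin n) (f-inj : Injective _≡_ _≡_ f) (a b : Fin n) (b≡1+a : toℕ b ≡ suc (toℕ a)) where
      τ = transpose a b
      unique = Unique.cartesianProduct⁺ (Unique.allFin⁺ n) (Unique.allFin⁺ n)

      H I : Fin n × Fin n → Carrier
      H (i , j) = if does (τ i <? τ j) ∧ does (f j <? f i) then - 1# else 1#
      I = uncurry (inversionSign f)

      τ² : Fin n × Fin n → Fin n × Fin n
      τ² (i , j) = τ i , τ j

      τ²-involutive : ∀ p → τ² (τ² p) ≡ p
      τ²-involutive (i , j) = ≡.cong₂ _,_ (transpose-involutive a b i) (transpose-involutive a b j)

      sgn-∘τ≈ΠH : sgn (f ∘ τ) ≈ Π (pairs n) H
      sgn-∘τ≈ΠH = trans (sym (Π-cartesianProduct (allFin n) (allFin n) _)) (sym (Π-reindex (pairs n) (pairs n) unique unique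
        (λ _ → yes tt) (λ _ → yes tt) H (uncurry (inversionSign (f ∘ τ))) τ² τ² (λ _ ¬t → ⊥-elim (¬t tt)) (λ _ ¬t → ⊥-elim (¬t tt))
        (λ {p} _ _ → ∈-pairs _ , tt , τ²-involutive p , reflexive (H-τ² p)) (λ {p} _ _ → ∈-pairs _ , tt , τ²-involutive p)))
        where
        H-τ² : ∀ p → uncurry (inversionSign (f ∘ τ)) (τ² p) ≡ H p
        H-τ² (i , j) = ≡.cong₂ (λ u v → if does (τ i <? τ j) ∧ does (f u <? f v) then - 1# else 1#)
                         (transpose-involutive a b j) (transpose-involutive a b i)

      ab ba : Fin n × Fin n
      ab = a , b
      ba = b , a

      a<b : a F.< b
      a<b = ≡.subst (toℕ a ℕ.<_) (≡.sym b≡1+a) (ℕ.n<1+n _)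

      b≮a : ¬ b F.< a
      b≮a = ℕ.<-asym a<b

      rest : (Fin n × Fin n → Carrier) → Fin n × Fin n → Carrier
      rest h = except _≟ₚ_ ba (except _≟ₚ_ ab h)

      Π-extract₂ : ∀ h → Π (pairs n) h ≈ h ab * (h ba * Π (pairs n) (rest h))
      Π-extract₂ h = trans (Π-extract _≟ₚ_ (pairs n) unique (∈-pairs ab))
                       (*-congˡ (trans (Π-extract _≟ₚ_ (pairs n) unique (∈-pairs ba))
                         (*-congʳ (reflexive (if-no (ba ≟ₚ ab) ba≢ab)))))
        where
        ba≢ab : ba ≢ ab
        ba≢ab eq = ℕ.<-irrefl (≡.sym (≡.cong (toℕ ∘ proj₁) eq)) a<b

      H-ab : H ab ≈ 1#
      H-ab = reflexive (≡.cong (λ z → if z ∧ does (f b <? f a) then - 1# else 1#)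
               (≡.trans (≡.cong₂ (λ u v → does (u <? v)) (transpose-matchˡ a b) (transpose-matchʳ a b)) (dec-false (b <? a) b≮a)))

      I-ba : I ba ≈ 1#
      I-ba = reflexive (≡.cong (λ z → if z ∧ does (f a <? f b) then - 1# else 1#) (dec-false (b <? a) b≮a))

      H-ba : H ba ≈ - I ab
      H-ba rewrite ≡.cong₂ (λ u v → does (u <? v)) (transpose-matchʳ a b) (transpose-matchˡ a b) | dec-true (a <? b) a<b
        with <-cmp (f a) (f b)
      ... | tri< fa<fb _ fb≮fa rewrite dec-true (f a <? f b) fa<fb | dec-false (f b <? f a) fb≮fa = ≈-refl
      ... | tri≈ _ fa≡fb _ = ⊥-elim (ℕ.<-irrefl (≡.cong toℕ (f-inj fa≡fb)) a<b)
      ... | tri> fa≮fb _ fb<fa rewrite dec-false (f a <? f b) fa≮fb | dec-true (f b <? f a) fb<fa = sym (-‿involutive 1#)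

      rest-agree : ∀ p → rest H p ≈ rest I p
      rest-agree p with p ≟ₚ ba
      ... | yes _ = ≈-refl
      ... | no p≢ba with p ≟ₚ ab
      ...   | yes _ = ≈-refl
      ...   | no p≢ab = reflexive (≡.cong (λ z → if z ∧ does (f (proj₂ p) <? f (proj₁ p)) then - 1# else 1#)
                          (does-⇔ (AdjacentTransposition.preserves-< a b b≡1+a (proj₁ p) (proj₂ p) p≢ab p≢ba)
                                  (τ (proj₁ p) <? τ (proj₂ p)) (proj₁ p <? proj₂ p)))

      ΠH≈-ΠI : Π (pairs n) H ≈ - Π (pairs n) I
      ΠH≈-ΠI = begin
        Π (pairs n) H                               ≈⟨ Π-extract₂ H ⟩
        H ab * (H ba * Π (pairs n) (rest H))        ≈⟨ *-cong H-ab (*-cong H-ba (Π-cong′ (pairs n) rest-agree)) ⟩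
        1# * (- I ab * Π (pairs n) (rest I))        ≈⟨ *-identityˡ _ ⟩
        - I ab * Π (pairs n) (rest I)               ≈⟨ -‿distribˡ-* _ _ ⟨
        - (I ab * Π (pairs n) (rest I))             ≈⟨ -‿cong (*-congˡ (trans (*-congʳ I-ba) (*-identityˡ _))) ⟨
        - (I ab * (I ba * Π (pairs n) (rest I)))    ≈⟨ -‿cong (Π-extract₂ I) ⟨
        - Π (pairs n) I                             ∎

    sgn-∘-adjacent : ∀ {n} (f : Fin n → Fin n) → Injective _≡_ _≡_ f → (a b : Fin n) → toℕ b ≡ suc (toℕ a) →
                     sgn (f ∘ transpose a b) ≈ - sgn f
    sgn-∘-adjacent {n} f f-inj a b b≡1+a =
      trans sgn-∘τ≈ΠH (trans ΠH≈-ΠI (-‿cong (Π-cartesianProduct (allFin n) (allFin n) _)))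
      where open Adjacent f f-inj a b b≡1+a

    private
      -- induction on the gap g, conjugating (a b) by the adjacent transposition (a a+1)
      sgn-∘-transpose-gap : ∀ g {n} (f : Fin n → Fin n) → Injective _≡_ _≡_ f → (a b : Fin n) →
                            toℕ b ≡ suc (toℕ a) ℕ.+ g → sgn (f ∘ transpose a b) ≈ - sgn f
      sgn-∘-transpose-gap zero    f f-inj a b b≡ = sgn-∘-adjacent f f-inj a b (≡.trans b≡ (ℕ.+-identityʳ _))
      sgn-∘-transpose-gap (suc g) {n} f f-inj a b b≡ = begin
          sgn (f ∘ transpose a b)
            ≈⟨ sgn-cong (≡.cong f ∘ conj) ⟩
          sgn (((f ∘ transpose a a′) ∘ transpose a′ b) ∘ transpose a a′)
            ≈⟨ sgn-∘-adjacent (f ∘ transpose a a′ ∘ transpose a′ b) (transpose-injective a′ b ∘ f′-inj) a a′ a′≡1+a ⟩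
          - sgn ((f ∘ transpose a a′) ∘ transpose a′ b)
            ≈⟨ -‿cong (sgn-∘-transpose-gap g (f ∘ transpose a a′) f′-inj a′ b b≡′) ⟩
          - - sgn (f ∘ transpose a a′)
            ≈⟨ -‿involutive _ ⟩
          sgn (f ∘ transpose a a′)
            ≈⟨ sgn-∘-adjacent f f-inj a a′ a′≡1+a ⟩
          - sgn f ∎
        where
        1+a<n : suc (toℕ a) ℕ.< n
        1+a<n = ℕ.<-trans (≡.subst (suc (toℕ a) ℕ.<_) (≡.sym b≡) (ℕ.m<m+n _ (ℕ.s≤s ℕ.z≤n))) (toℕ<n b)
        a′ : Fin n
        a′ = fromℕ< 1+a<n
        a′≡1+a : toℕ a′ ≡ suc (toℕ a)
        a′≡1+a = toℕ-fromℕ< 1+a<n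
        b≡′ : toℕ b ≡ suc (toℕ a′) ℕ.+ g
        b≡′ = ≡.trans b≡ (≡.trans (ℕ.+-suc (suc (toℕ a)) g) (≡.cong (λ z → suc z ℕ.+ g) (≡.sym a′≡1+a)))
        a<a′ : toℕ a ℕ.< toℕ a′
        a<a′ = ≡.subst (toℕ a ℕ.<_) (≡.sym a′≡1+a) (ℕ.n<1+n _)
        a′<b : toℕ a′ ℕ.< toℕ b
        a′<b = ≡.subst (toℕ a′ ℕ.<_) (≡.sym b≡′) (ℕ.m≤m+n (suc (toℕ a′)) g)
        conj : ∀ x → transpose a b x ≡ transpose a a′ (transpose a′ b (transpose a a′ x))
        conj x = transpose-conjugate a b a′ x (λ a≡b → ℕ.<-irrefl (≡.cong toℕ a≡b) (ℕ.<-trans a<a′ a′<b))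
                   (λ a≡a′ → ℕ.<-irrefl (≡.cong toℕ a≡a′) a<a′) (λ a′≡b → ℕ.<-irrefl (≡.cong toℕ a′≡b) a′<b)
        f′-inj : Injective _≡_ _≡_ (f ∘ transpose a a′)
        f′-inj = transpose-injective a a′ ∘ f-inj

    sgn-∘-transpose : ∀ {n} (f : Fin n → Fin n) → Injective _≡_ _≡_ f → (a b : Fin n) → a ≢ b →
                      sgn (f ∘ transpose a b) ≈ - sgn f
    sgn-∘-transpose f f-inj a b a≢b with <-cmp a b
    ... | tri< a<b _ _ = sgn-∘-transpose-gap (toℕ b ∸ suc (toℕ a)) f f-inj a b (≡.sym (ℕ.m+[n∸m]≡n a<b))
    ... | tri≈ _ a≡b _ = ⊥-elim (a≢b a≡b)
    ... | tri> _ _ b<a = trans (sgn-cong (≡.cong f ∘ transpose-comm a b))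
                               (sgn-∘-transpose-gap (toℕ a ∸ suc (toℕ b)) f f-inj b a (≡.sym (ℕ.m+[n∸m]≡n b<a)))

module Enumeration where

  open import Data.Nat as ℕ using (ℕ; zero; suc)
  open import Data.Fin using (Fin; zero; suc)
  open import Data.Fin.Properties using (_≟_)
  open import Data.Vec as V using (Vec; []; _∷_)
  import Data.Vec.Properties as V
  open import Data.Bool using (Bool; true; false)
  open import Data.Maybe using (Maybe; nothing; just)
  open import Data.List as L using (List; []; _∷_; map; concatMap; allFin; upTo)
  open import Data.List.Membership.Propositional using (_∈_; lose; find)
  open import Data.List.Membership.Propositional.Properties
    using (∈-map⁺; ∈-map⁻; ∈-allFin; ∈-upTo⁺; ∈-lookup; ∈-concatMap⁺; ∈-concatMap⁻)
  open import Data.List.Relation.Unary.Any using (here; there)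
  open import Data.List.Relation.Unary.All as All using ([]; _∷_)
  open import Data.List.Relation.Unary.AllPairs using ([]; _∷_)
  open import Data.List.Relation.Unary.Unique.Propositional using (Unique)
  import Data.List.Relation.Unary.Unique.Propositional.Properties as Unique
  open import Relation.Binary.PropositionalEquality as ≡ using (_≡_; _≢_; refl)
  open import Relation.Nullary using (Dec; yes; no)
  open import Relation.Nullary.Decidable using (map′)
  open import Data.Product using (Σ; _,_; proj₁; proj₂)
  open import Data.Empty using (⊥-elim)
  open import Defs using (vecs; bools; maybes)

  module _ {a b} {A : Set a} {B : Set b} where

    concatMap⁺-Unique : ∀ (g : A → List B) {xs} → Unique xs → (∀ x → Unique (g x)) →
                        (∀ {x x′ y} → y ∈ g x → y ∈ g x′ → x ≡ x′) → Unique (concatMap g xs)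
    concatMap⁺-Unique g {[]}     _         _  _        = []
    concatMap⁺-Unique g {x ∷ xs} (x∉ ∷ u) ug disjoint =
      Unique.++⁺ (ug x) (concatMap⁺-Unique g u ug disjoint)
        (λ (y∈gx , y∈rest) → let (x′ , x′∈ , y∈gx′) = find (∈-concatMap⁻ g y∈rest) in
                              All.lookup x∉ x′∈ (disjoint y∈gx y∈gx′))

  module _ {a} {A : Set a} where

    ∈-vecs : ∀ {xs : List A} → (∀ x → x ∈ xs) → ∀ {k} (v : Vec A k) → v ∈ vecs xs k
    ∈-vecs all []      = here refl
    ∈-vecs all (x ∷ v) = ∈-concatMap⁺ _ (lose (all x) (∈-map⁺ (x ∷_) (∈-vecs all v)))

    vecs⁺-Unique : ∀ {xs : List A} → Unique xs → ∀ k → Unique (vecs xs k)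
    vecs⁺-Unique u zero    = [] ∷ []
    vecs⁺-Unique u (suc k) = concatMap⁺-Unique _ u
      (λ _ → Unique.map⁺ (λ eq → proj₂ (V.∷-injective eq)) (vecs⁺-Unique u k))
      (λ v∈ v∈′ → let (_ , _ , eq) = ∈-map⁻ _ v∈ ; (_ , _ , eq′) = ∈-map⁻ _ v∈′ in
                   proj₁ (V.∷-injective (≡.trans (≡.sym eq) eq′)))

    lookup-injective : ∀ {xs : List A} → Unique xs → ∀ i j → L.lookup xs i ≡ L.lookup xs j → i ≡ j
    lookup-injective (_ ∷ _)  zero    zero    _  = refl
    lookup-injective (x∉ ∷ _) zero    (suc j) eq = ⊥-elim (All.lookup x∉ (∈-lookup j) eq)
    lookup-injective (x∉ ∷ _) (suc i) zero    eq = ⊥-elim (All.lookup x∉ (∈-lookup i) (≡.sym eq))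
    lookup-injective (_ ∷ u)  (suc i) (suc j) eq = ≡.cong suc (lookup-injective u i j eq)

  ∈-bools : ∀ b → b ∈ bools
  ∈-bools true  = here refl
  ∈-bools false = there (here refl)

  bools⁺-Unique : Unique bools
  bools⁺-Unique = ((λ ()) ∷ []) ∷ ([] ∷ [])

  module _ {a} {A : Set a} {xs : List A} where

    ∈-maybes : (∀ x → x ∈ xs) → ∀ mx → mx ∈ maybes xs
    ∈-maybes all nothing  = here refl
    ∈-maybes all (just x) = there (∈-map⁺ just (all x))

    maybes⁺-Unique : Unique xs → Unique (maybes xs)
    maybes⁺-Unique u = All.tabulate nothing∉ ∷ Unique.map⁺ (λ { refl → refl }) u
      where
      nothing∉ : ∀ {y} → y ∈ map just xs → nothing ≢ y
      nothing∉ y∈ eq with ∈-map⁻ just y∈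
      ... | _ , _ , refl with eq
      ...   | ()

  CycleRep : ℕ → Set
  CycleRep n = Σ ℕ λ k → Vec (Fin n) (suc k)

  _≟ᶻ_ : ∀ {n} (z z′ : CycleRep n) → Dec (z ≡ z′)
  (k , zs) ≟ᶻ (k′ , zs′) with k ℕ.≟ k′
  ... | no k≢k′ = no (λ z≡z′ → k≢k′ (≡.cong proj₁ z≡z′))
  ... | yes refl = map′ (≡.cong (k ,_)) (λ { refl → refl }) (V.≡-dec _≟_ zs zs′)

  cycleReps : ∀ n → List (CycleRep n)
  cycleReps n = concatMap (λ k → map (k ,_) (vecs (allFin n) (suc k))) (upTo n)

  cycleReps⁺-Unique : ∀ n → Unique (cycleReps n)
  cycleReps⁺-Unique n = concatMap⁺-Unique _ (Unique.upTo⁺ n)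
    (λ k → Unique.map⁺ (λ { refl → refl }) (vecs⁺-Unique (Unique.allFin⁺ n) (suc k)))
    (λ z∈ z∈′ → let (_ , _ , eq) = ∈-map⁻ _ z∈ ; (_ , _ , eq′) = ∈-map⁻ _ z∈′ in
                 ≡.trans (≡.cong proj₁ (≡.sym eq)) (≡.cong proj₁ eq′))

  ∈-cycleReps : ∀ {n k} (zs : Vec (Fin n) (suc k)) → k ℕ.< n → (k , zs) ∈ cycleReps n
  ∈-cycleReps zs k<n = ∈-concatMap⁺ _ (lose (∈-upTo⁺ k<n) (∈-map⁺ (_ ,_) (∈-vecs ∈-allFin zs)))

module Cycles where

  open import Function using (_∘_)
  open import Function.Definitions using (Injective)
  open import Data.Nat as ℕ using (ℕ; zero; suc)
  import Data.Nat.Properties as ℕ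
  open import Data.Fin as F using (Fin; zero; suc; toℕ; fromℕ<; fromℕ; inject₁)
  open import Data.Fin.Properties
    using (_≟_; _≤?_; toℕ-injective; toℕ-fromℕ<; toℕ-fromℕ; toℕ-inject₁; inject₁-injective; fromℕ≢inject₁;
           all?; injective⇒≤; toℕ<n; fromℕ<-toℕ; ≤-antisym)
  open import Data.Fin.Relation.Unary.Top using (view; ‵fromℕ; ‵inject₁)
  open import Data.Vec as V using (Vec; []; _∷_; lookup; _∷ʳ_)
  import Data.Vec.Properties as V
  open import Data.List.Membership.Propositional using (_∈_)
  open import Relation.Binary.PropositionalEquality as ≡ using (_≡_; _≢_; refl; cong; sym; trans)
  open import Relation.Binary.Definitions using (tri<; tri≈; tri>)
  open import Relation.Nullary using (Dec; yes; no; ¬_)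
  open import Relation.Nullary.Decidable using (map′; _×-dec_; _→-dec_)
  open import Data.Product using (∃; _×_; _,_; proj₂)
  open import Data.Empty using (⊥-elim)
  open import Defs using (next)
  open Enumeration using (CycleRep; cycleReps; ∈-cycleReps)

  lookup-ext : ∀ {a} {A : Set a} {k} {xs ys : Vec A k} → (∀ i → lookup xs i ≡ lookup ys i) → xs ≡ ys
  lookup-ext {xs = xs} {ys} eq = trans (sym (V.tabulate∘lookup xs)) (trans (V.tabulate-cong eq) (V.tabulate∘lookup ys))

  module _ {a} {A : Set a} where

    lookup-∷ʳ-inject₁ : ∀ {k} (xs : Vec A k) x i → lookup (xs ∷ʳ x) (inject₁ i) ≡ lookup xs i
    lookup-∷ʳ-inject₁ (_ ∷ xs) x zero    = refl
    lookup-∷ʳ-inject₁ (_ ∷ xs) x (suc i) = lookup-∷ʳ-inject₁ xs x i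

    lookup-∷ʳ-fromℕ : ∀ {k} (xs : Vec A k) x → lookup (xs ∷ʳ x) (fromℕ k) ≡ x
    lookup-∷ʳ-fromℕ []       x = refl
    lookup-∷ʳ-fromℕ (_ ∷ xs) x = lookup-∷ʳ-fromℕ xs x

  module _ {k : ℕ} where

    toℕ-next : ∀ (j : Fin (suc k)) → toℕ j ℕ.< k → toℕ (next j) ≡ suc (toℕ j)
    toℕ-next j j<k with suc (toℕ j) ℕ.<? suc k
    ... | yes 1+j<1+k = toℕ-fromℕ< 1+j<1+k
    ... | no  1+j≮1+k = ⊥-elim (1+j≮1+k (ℕ.s≤s j<k))

    next-fromℕ : next (fromℕ k) ≡ zero
    next-fromℕ with suc (toℕ (fromℕ k)) ℕ.<? suc k
    ... | yes lt = ⊥-elim (ℕ.<-irrefl (toℕ-fromℕ k) (ℕ.≤-pred lt))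
    ... | no  _  = refl

    next≡zero⇒≡fromℕ : ∀ (j : Fin (suc k)) → next j ≡ zero → j ≡ fromℕ k
    next≡zero⇒≡fromℕ j eq with suc (toℕ j) ℕ.<? suc k
    ... | yes lt = ⊥-elim (ℕ.0≢1+n (sym (trans (sym (toℕ-fromℕ< lt)) (cong toℕ eq))))
    ... | no  nlt = toℕ-injective (trans (ℕ.≤-antisym (ℕ.≤-pred (toℕ<n j)) (ℕ.≮⇒≥ (nlt ∘ ℕ.s≤s))) (sym (toℕ-fromℕ k)))

    ≢fromℕ⇒< : ∀ (j : Fin (suc k)) → j ≢ fromℕ k → toℕ j ℕ.< k
    ≢fromℕ⇒< j j≢ = ℕ.≤∧≢⇒< (ℕ.≤-pred (toℕ<n j)) (λ eq → j≢ (toℕ-injective (trans eq (sym (toℕ-fromℕ k)))))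

  next-inject₁ : ∀ {k} (i : Fin (suc k)) → i ≢ fromℕ k → next (inject₁ i) ≡ inject₁ (next i)
  next-inject₁ {k} i i≢ = toℕ-injective (begin
      toℕ (next (inject₁ i))  ≡⟨ toℕ-next (inject₁ i) (ℕ.s≤s (ℕ.<⇒≤ (≡.subst (ℕ._< k) (sym (toℕ-inject₁ i)) (≢fromℕ⇒< i i≢)))) ⟩
      suc (toℕ (inject₁ i))   ≡⟨ cong suc (toℕ-inject₁ i) ⟩
      suc (toℕ i)             ≡⟨ toℕ-next i (≢fromℕ⇒< i i≢) ⟨
      toℕ (next i)            ≡⟨ toℕ-inject₁ _ ⟨
      toℕ (inject₁ (next i))  ∎)
    where open ≡.≡-Reasoning

  next-inject₁-fromℕ : ∀ {k} → next (inject₁ (fromℕ k)) ≡ fromℕ (suc k)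
  next-inject₁-fromℕ {k} = toℕ-injective (trans (toℕ-next (inject₁ (fromℕ k)) (≡.subst (ℕ._< suc k) (sym last≡k) (ℕ.n<1+n k)))
                                            (trans (cong suc last≡k) (sym (toℕ-fromℕ (suc k)))))
    where
    last≡k : toℕ (inject₁ (fromℕ k)) ≡ k
    last≡k = trans (toℕ-inject₁ _) (toℕ-fromℕ k)

  next-≢ : ∀ {k} (j : Fin (suc (suc k))) → next j ≢ j
  next-≢ {k} j eq with fromℕ (suc k) ≟ j
  ... | yes refl = ℕ.0≢1+n (trans (cong toℕ (trans (sym next-fromℕ) eq)) (toℕ-fromℕ (suc k)))
  ... | no  j≢   = ℕ.<-irrefl (trans (cong toℕ (sym eq)) (toℕ-next j (≢fromℕ⇒< j (j≢ ∘ sym)))) (ℕ.n<1+n (toℕ j))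

  iterate : ∀ {n} → (Fin n → Fin n) → ℕ → Fin n → Fin n
  iterate τ zero    x = x
  iterate τ (suc i) x = τ (iterate τ i x)

  module _ {n : ℕ} where

    headOf lastOf : CycleRep n → Fin n
    headOf (k , zs) = lookup zs zero
    lastOf (k , zs) = lookup zs (fromℕ k)

    -- z lists a cycle of τ in the rotation that starts at its least element;
    -- this is how connector cycles are recorded in Defs.
    record IsCycle (τ : Fin n → Fin n) (z : CycleRep n) : Set where
      constructor isCycle
      field
        step        : ∀ j → lookup (proj₂ z) (next j) ≡ τ (lookup (proj₂ z) j)
        injective   : ∀ j j′ → lookup (proj₂ z) j ≡ lookup (proj₂ z) j′ → j ≡ j′
        headMinimal : ∀ j → headOf z F.≤ lookup (proj₂ z) j

    isCycle? : ∀ τ z → Dec (IsCycle τ z)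
    isCycle? τ (k , zs) = map′ (λ (s , i , h) → isCycle s i h) (λ (isCycle s i h) → s , i , h)
      (all? (λ j → lookup zs (next j) ≟ τ (lookup zs j)) ×-dec
       all? (λ j → all? (λ j′ → (lookup zs j ≟ lookup zs j′) →-dec (j ≟ j′))) ×-dec
       all? (λ j → lookup zs zero ≤? lookup zs j))

    module _ {τ : Fin n → Fin n} where
      open IsCycle

      fixed⇒singleton : ∀ {k zs} → IsCycle τ (k , zs) → ∀ j → τ (lookup zs j) ≡ lookup zs j → k ≡ 0
      fixed⇒singleton {zero}  c j eq = refl
      fixed⇒singleton {suc k} c j eq = ⊥-elim (next-≢ j (injective c _ _ (trans (step c j) eq)))

      returnsToHead⇒last : ∀ {k zs} → IsCycle τ (k , zs) → ∀ j → τ (lookup zs j) ≡ lookup zs zero → j ≡ fromℕ k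
      returnsToHead⇒last c j eq = next≡zero⇒≡fromℕ j (injective c _ _ (trans (step c j) eq))

      head≡leastNonFixed : ∀ {m} → (∀ x → τ x ≢ x → m F.≤ x) →
                           ∀ {k zs} → IsCycle τ (k , zs) → ∀ j → τ (lookup zs j) ≡ m → lookup zs zero ≡ m
      head≡leastNonFixed least {zero} {zs} c j eq with next j in next-j
      ... | zero = trans (sym (cong (lookup zs) next-j)) (trans (step c j) eq)
      head≡leastNonFixed least {suc k} {zs} c j eq =
        ≤-antisym (≡.subst (lookup zs zero F.≤_) (trans (step c j) eq) (headMinimal c (next j)))
                  (least (lookup zs zero) (λ fixed → ℕ.0≢1+n (sym (fixed⇒singleton c zero fixed))))

      IsCycle-cong : ∀ {τ′ : Fin n → Fin n} {k zs} → IsCycle τ (k , zs) →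
                     (∀ j → τ′ (lookup zs j) ≡ τ (lookup zs j)) → IsCycle τ′ (k , zs)
      IsCycle-cong c agree = isCycle (λ j → trans (step c j) (sym (agree j))) (injective c) (headMinimal c)

      lookup≡iterate : ∀ {k zs} → IsCycle τ (k , zs) → ∀ i (i<1+k : i ℕ.< suc k) →
                       lookup zs (fromℕ< i<1+k) ≡ iterate τ i (lookup zs zero)
      lookup≡iterate c zero    _      = refl
      lookup≡iterate {k} {zs} c (suc i) 1+i<1+k =
        trans (cong (lookup zs) (sym next-i≡)) (trans (step c (fromℕ< i<1+k)) (cong τ (lookup≡iterate c i i<1+k)))
        where
        i<1+k : i ℕ.< suc k
        i<1+k = ℕ.<-trans (ℕ.n<1+n i) 1+i<1+k
        next-i≡ : next (fromℕ< i<1+k) ≡ fromℕ< 1+i<1+k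
        next-i≡ = toℕ-injective (trans (toℕ-next _ (≡.subst (ℕ._< k) (sym (toℕ-fromℕ< i<1+k)) (ℕ.≤-pred 1+i<1+k)))
                    (trans (cong suc (toℕ-fromℕ< i<1+k)) (sym (toℕ-fromℕ< 1+i<1+k))))

      lookup≡iterate′ : ∀ {k zs} → IsCycle τ (k , zs) → ∀ j → lookup zs j ≡ iterate τ (toℕ j) (lookup zs zero)
      lookup≡iterate′ {zs = zs} c j = trans (cong (lookup zs) (sym (fromℕ<-toℕ j (toℕ<n j)))) (lookup≡iterate c (toℕ j) (toℕ<n j))

      private
        noShorter : ∀ {k₁ zs₁ k₂ zs₂} → IsCycle τ (k₁ , zs₁) → IsCycle τ (k₂ , zs₂) →
                    lookup zs₁ zero ≡ lookup zs₂ zero → ¬ k₁ ℕ.< k₂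
        noShorter {k₁} {zs₁} {k₂} {zs₂} c₁ c₂ heads k₁<k₂ =
          ℕ.0≢1+n (sym (trans (sym (toℕ-fromℕ< 1+k₁<1+k₂)) (cong toℕ (injective c₂ _ _ returns))))
          where
          1+k₁<1+k₂ = ℕ.s≤s k₁<k₂
          k₁<1+k₁ = ℕ.n<1+n k₁
          fromℕ<≡fromℕ : fromℕ< k₁<1+k₁ ≡ fromℕ k₁
          fromℕ<≡fromℕ = toℕ-injective (trans (toℕ-fromℕ< k₁<1+k₁) (sym (toℕ-fromℕ k₁)))
          returns : lookup zs₂ (fromℕ< 1+k₁<1+k₂) ≡ lookup zs₂ zero
          returns = begin
            lookup zs₂ (fromℕ< 1+k₁<1+k₂)              ≡⟨ lookup≡iterate c₂ (suc k₁) 1+k₁<1+k₂ ⟩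
            τ (iterate τ k₁ (lookup zs₂ zero))          ≡⟨ cong (τ ∘ iterate τ k₁) heads ⟨
            τ (iterate τ k₁ (lookup zs₁ zero))          ≡⟨ cong τ (lookup≡iterate c₁ k₁ k₁<1+k₁) ⟨
            τ (lookup zs₁ (fromℕ< k₁<1+k₁))            ≡⟨ cong (τ ∘ lookup zs₁) fromℕ<≡fromℕ ⟩
            τ (lookup zs₁ (fromℕ k₁))                  ≡⟨ step c₁ (fromℕ k₁) ⟨
            lookup zs₁ (next (fromℕ k₁))               ≡⟨ cong (lookup zs₁) next-fromℕ ⟩
            lookup zs₁ zero                            ≡⟨ heads ⟩
            lookup zs₂ zero                            ∎
            where open ≡.≡-Reasoning

      sameHead⇒≡ : ∀ {z₁ z₂} → IsCycle τ z₁ → IsCycle τ z₂ → headOf z₁ ≡ headOf z₂ → z₁ ≡ z₂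
      sameHead⇒≡ {k₁ , zs₁} {k₂ , zs₂} c₁ c₂ heads with ℕ.<-cmp k₁ k₂
      ... | tri< k₁<k₂ _ _ = ⊥-elim (noShorter c₁ c₂ heads k₁<k₂)
      ... | tri> _ _ k₂<k₁ = ⊥-elim (noShorter c₂ c₁ (sym heads) k₂<k₁)
      ... | tri≈ _ refl _ = cong (k₁ ,_) (lookup-ext λ j →
            trans (lookup≡iterate′ c₁ j) (trans (cong (iterate τ (toℕ j)) heads) (sym (lookup≡iterate′ c₂ j))))

      IsCycle⇒∈cycleReps : ∀ {z} → IsCycle τ z → z ∈ cycleReps n
      IsCycle⇒∈cycleReps {k , zs} c = ∈-cycleReps zs (injective⇒≤ (injective c _ _))

  -- Cutting p out of the cycle  m → … → r → p → m  of σ, where m is the least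
  -- non-fixed point: σ′ = σ ∘ (r p) has the cycle  m → … → r → m  and fixes p.
  module CutOut {n} (σ : Fin n → Fin n) (σ-inj : Injective _≡_ _≡_ σ) {m p r : Fin n}
    (σp≡m : σ p ≡ m) (σr≡p : σ r ≡ p) (p≢m : p ≢ m) (least : ∀ x → σ x ≢ x → m F.≤ x) where

    open import Data.Fin.Permutation.Components using (transpose)
    open PermutationSign using (transpose-matchˡ; transpose-matchʳ; transpose-mismatch; transpose-injective;
      position; atˡ; atʳ; away)
    open IsCycle

    r≢p : r ≢ p
    r≢p r≡p = p≢m (trans (sym (≡.subst (λ x → σ x ≡ p) r≡p σr≡p)) σp≡m)

    σp≢p : σ p ≢ p
    σp≢p σp≡p = p≢m (trans (sym σp≡p) σp≡m)

    σ′ : Fin n → Fin n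
    σ′ = σ ∘ transpose r p

    σ′r≡m : σ′ r ≡ m
    σ′r≡m = trans (cong σ (transpose-matchˡ r p)) σp≡m

    σ′p≡p : σ′ p ≡ p
    σ′p≡p = trans (cong σ (transpose-matchʳ r p)) σr≡p

    σ′≡σ : ∀ x → x ≢ r → x ≢ p → σ′ x ≡ σ x
    σ′≡σ x x≢r x≢p = cong σ (transpose-mismatch r p x x≢r x≢p)

    σ′-injective : Injective _≡_ _≡_ σ′
    σ′-injective = transpose-injective r p ∘ σ-inj

    σ′-nonFixed⇒σ-nonFixed : ∀ x → σ′ x ≢ x → σ x ≢ x
    σ′-nonFixed⇒σ-nonFixed x σ′x≢x σx≡x with position r p x
    ... | atˡ refl = r≢p (trans (sym σx≡x) σr≡p)
    ... | atʳ _ refl = σ′x≢x σ′p≡p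
    ... | away x≢r x≢p = σ′x≢x (trans (σ′≡σ x x≢r x≢p) σx≡x)

    least′ : ∀ x → σ′ x ≢ x → m F.≤ x
    least′ x = least x ∘ σ′-nonFixed⇒σ-nonFixed x

    extend : CycleRep n → CycleRep n
    extend (k , zs) = (suc k , zs ∷ʳ p)

    lastOf-extend : ∀ z → lastOf (extend z) ≡ p
    lastOf-extend (k , zs) = lookup-∷ʳ-fromℕ zs p

    σ′-cycle-avoids-p : ∀ {k zs} → IsCycle σ′ (k , zs) → lastOf (k , zs) ≢ p → ∀ j → lookup zs j ≢ p
    σ′-cycle-avoids-p {k} {zs} c last≢p j zj≡p with fixed⇒singleton c j (trans (cong σ′ zj≡p) (trans σ′p≡p (sym zj≡p)))
    σ′-cycle-avoids-p {zero} {zs} c last≢p zero zj≡p | refl = last≢p zj≡p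

    σ′-head≡m : ∀ {k zs} → IsCycle σ′ (k , zs) → lastOf (k , zs) ≡ r → lookup zs zero ≡ m
    σ′-head≡m {k} {zs} c last≡r = trans (cong (lookup zs) (sym next-fromℕ)) (trans (step c (fromℕ k)) (trans (cong σ′ last≡r) σ′r≡m))

    extend-IsCycle : ∀ {k zs} → IsCycle σ′ (k , zs) → lastOf (k , zs) ≡ r → IsCycle σ (extend (k , zs))
    extend-IsCycle {k} {zs} c last≡r = isCycle step′ injective′ headMinimal′
      where
      avoids = σ′-cycle-avoids-p c (λ last≡p → r≢p (trans (sym last≡r) last≡p))
      ys = zs ∷ʳ p
      head≡ : lookup ys zero ≡ lookup zs zero
      head≡ = lookup-∷ʳ-inject₁ zs p zero
      step′ : ∀ i → lookup ys (next i) ≡ σ (lookup ys i)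
      step′ i with view i
      ... | ‵inject₁ i′ with i′ ≟ fromℕ k
      ...   | yes refl = begin
              lookup ys (next (inject₁ (fromℕ k)))  ≡⟨ cong (lookup ys) next-inject₁-fromℕ ⟩
              lookup ys (fromℕ (suc k))             ≡⟨ lookup-∷ʳ-fromℕ zs p ⟩
              p                                     ≡⟨ σr≡p ⟨
              σ r                                   ≡⟨ cong σ (trans (lookup-∷ʳ-inject₁ zs p (fromℕ k)) last≡r) ⟨
              σ (lookup ys (inject₁ (fromℕ k)))     ∎
        where open ≡.≡-Reasoning
      ...   | no i′≢ = begin
              lookup ys (next (inject₁ i′))  ≡⟨ cong (lookup ys) (next-inject₁ i′ i′≢) ⟩
              lookup ys (inject₁ (next i′))  ≡⟨ lookup-∷ʳ-inject₁ zs p (next i′) ⟩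
              lookup zs (next i′)            ≡⟨ step c i′ ⟩
              σ′ (lookup zs i′)              ≡⟨ σ′≡σ _ (λ zi′≡r → i′≢ (injective c _ _ (trans zi′≡r (sym last≡r)))) (avoids i′) ⟩
              σ (lookup zs i′)               ≡⟨ cong σ (lookup-∷ʳ-inject₁ zs p i′) ⟨
              σ (lookup ys (inject₁ i′))     ∎
        where open ≡.≡-Reasoning
      step′ i | ‵fromℕ = trans (cong (lookup ys) next-fromℕ) (trans head≡ (trans (σ′-head≡m c last≡r)
                          (trans (sym σp≡m) (cong σ (sym (lookup-∷ʳ-fromℕ zs p))))))
      injective′ : ∀ i i′ → lookup ys i ≡ lookup ys i′ → i ≡ i′
      injective′ i i′ eq with view i | view i′
      ... | ‵inject₁ a | ‵inject₁ b = cong inject₁ (injective c a b (trans (sym (lookup-∷ʳ-inject₁ zs p a)) (trans eq (lookup-∷ʳ-inject₁ zs p b))))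
      ... | ‵inject₁ a | ‵fromℕ     = ⊥-elim (avoids a (trans (sym (lookup-∷ʳ-inject₁ zs p a)) (trans eq (lookup-∷ʳ-fromℕ zs p))))
      ... | ‵fromℕ     | ‵inject₁ b = ⊥-elim (avoids b (trans (sym (lookup-∷ʳ-inject₁ zs p b)) (trans (sym eq) (lookup-∷ʳ-fromℕ zs p))))
      ... | ‵fromℕ     | ‵fromℕ     = refl
      headMinimal′ : ∀ i → lookup ys zero F.≤ lookup ys i
      headMinimal′ i with view i
      ... | ‵inject₁ a = ≡.subst₂ F._≤_ (sym head≡) (sym (lookup-∷ʳ-inject₁ zs p a)) (headMinimal c a)
      ... | ‵fromℕ     = ≡.subst₂ F._≤_ (sym (trans head≡ (σ′-head≡m c last≡r))) (sym (lookup-∷ʳ-fromℕ zs p)) (least p σp≢p)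

    shorten-IsCycle : ∀ {k ys} → IsCycle σ (suc k , ys ∷ʳ p) → IsCycle σ′ (k , ys) × lastOf (k , ys) ≡ r
    shorten-IsCycle {k} {ys} c = isCycle step′ injective′ headMinimal′ , last≡r
      where
      zs = ys ∷ʳ p
      z≡ : ∀ i → lookup zs (inject₁ i) ≡ lookup ys i
      z≡ = lookup-∷ʳ-inject₁ ys p
      last≡r : lookup ys (fromℕ k) ≡ r
      last≡r = trans (sym (z≡ _)) (σ-inj (trans (sym (step c (inject₁ (fromℕ k))))
                 (trans (cong (lookup zs) next-inject₁-fromℕ) (trans (lookup-∷ʳ-fromℕ ys p) (sym σr≡p)))))
      head≡m : lookup ys zero ≡ m
      head≡m = trans (sym (z≡ zero)) (trans (cong (lookup zs) (sym next-fromℕ))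
                 (trans (step c (fromℕ (suc k))) (trans (cong σ (lookup-∷ʳ-fromℕ ys p)) σp≡m)))
      step′ : ∀ i → lookup ys (next i) ≡ σ′ (lookup ys i)
      step′ i with i ≟ fromℕ k
      ... | yes refl = trans (cong (lookup ys) next-fromℕ) (trans head≡m (sym (trans (cong σ′ last≡r) σ′r≡m)))
      ... | no i≢ = begin
            lookup ys (next i)             ≡⟨ z≡ (next i) ⟨
            lookup zs (inject₁ (next i))   ≡⟨ cong (lookup zs) (next-inject₁ i i≢) ⟨
            lookup zs (next (inject₁ i))   ≡⟨ step c (inject₁ i) ⟩
            σ (lookup zs (inject₁ i))      ≡⟨ cong σ (z≡ i) ⟩
            σ (lookup ys i)                ≡⟨ σ′≡σ _ yi≢r yi≢p ⟨
            σ′ (lookup ys i)               ∎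
        where
        open ≡.≡-Reasoning
        yi≢r : lookup ys i ≢ r
        yi≢r yi≡r = i≢ (inject₁-injective (injective c _ _ (trans (z≡ i) (trans yi≡r (trans (sym last≡r) (sym (z≡ _)))))))
        yi≢p : lookup ys i ≢ p
        yi≢p yi≡p = fromℕ≢inject₁ (sym (injective c _ _ (trans (z≡ i) (trans yi≡p (sym (lookup-∷ʳ-fromℕ ys p))))))
      injective′ : ∀ a b → lookup ys a ≡ lookup ys b → a ≡ b
      injective′ a b eq = inject₁-injective (injective c _ _ (trans (z≡ a) (trans eq (sym (z≡ b)))))
      headMinimal′ : ∀ i → lookup ys zero F.≤ lookup ys i
      headMinimal′ i = ≡.subst₂ F._≤_ (z≡ zero) (z≡ i) (headMinimal c (inject₁ i))

    shorten : CycleRep n → CycleRep n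
    shorten (zero  , zs) = zero , zs
    shorten (suc k , zs) = k , V.init zs

    shorten-extend : ∀ z → shorten (extend z) ≡ z
    shorten-extend (k , zs) = cong (k ,_) (V.init-∷ʳ p zs)

    lastOf≡p⇒≡extend : ∀ {z} → IsCycle σ z → lastOf z ≡ p → ∃ λ z′ → z ≡ extend z′
    lastOf≡p⇒≡extend {zero , zs} c last≡p = ⊥-elim (σp≢p (trans (cong σ (sym last≡p)) (trans (sym (step c zero)) last≡p)))
    lastOf≡p⇒≡extend {suc k , zs} c last≡p with V.initLast zs
    ... | ys , y , refl = (k , ys) , cong (λ y → suc k , ys ∷ʳ y) (trans (sym (lookup-∷ʳ-fromℕ ys y)) last≡p)

    σ-cycle-untouched : ∀ {k zs} → IsCycle σ (k , zs) → lastOf (k , zs) ≢ p → IsCycle σ′ (k , zs) × lastOf (k , zs) ≢ r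
    σ-cycle-untouched {k} {zs} c last≢p = IsCycle-cong c (λ j → σ′≡σ _ (≢r j) (≢p j)) , ≢r (fromℕ k)
      where
      ≢p : ∀ j → lookup zs j ≢ p
      ≢p j zj≡p = last≢p (≡.subst (λ i → lookup zs i ≡ p) (returnsToHead⇒last c j σzj≡head) zj≡p)
        where
        σzj≡m = trans (cong σ zj≡p) σp≡m
        σzj≡head = trans σzj≡m (sym (head≡leastNonFixed least c j σzj≡m))
      ≢r : ∀ j → lookup zs j ≢ r
      ≢r j zj≡r = ≢p (next j) (trans (step c j) (trans (cong σ zj≡r) σr≡p))

    σ′-cycle-untouched : ∀ {k zs} → IsCycle σ′ (k , zs) → lastOf (k , zs) ≢ p → lastOf (k , zs) ≢ r → IsCycle σ (k , zs)
    σ′-cycle-untouched {k} {zs} c last≢p last≢r = IsCycle-cong c (λ j → sym (σ′≡σ _ (≢r j) (σ′-cycle-avoids-p c last≢p j)))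
      where
      ≢r : ∀ j → lookup zs j ≢ r
      ≢r j zj≡r = last≢r (≡.subst (λ i → lookup zs i ≡ r) (returnsToHead⇒last c j σ′zj≡head) zj≡r)
        where
        σ′zj≡m = trans (cong σ′ zj≡r) σ′r≡m
        σ′zj≡head = trans σ′zj≡m (sym (head≡leastNonFixed least′ c j σ′zj≡m))

    lastOf≡r-unique : ∀ {z₁ z₂} → IsCycle σ′ z₁ → IsCycle σ′ z₂ → lastOf z₁ ≡ r → lastOf z₂ ≡ r → z₁ ≡ z₂
    lastOf≡r-unique {_ , _} {_ , _} c₁ c₂ last₁ last₂ = sameHead⇒≡ c₁ c₂ (trans (σ′-head≡m c₁ last₁) (sym (σ′-head≡m c₂ last₂)))

    lastOf≡p⇒singleton : ∀ {k zs} → IsCycle σ′ (k , zs) → lastOf (k , zs) ≡ p → k ≡ 0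
    lastOf≡p⇒singleton c last≡p = fixed⇒singleton c _ (trans (cong σ′ last≡p) (trans σ′p≡p (sym last≡p)))

module CycleSign where

  open import Function using (_∘_)
  open import Function.Definitions using (Injective)
  open import Algebra.Bundles using (CommutativeRing)
  open import Data.Nat as ℕ using (ℕ; zero; suc)
  import Data.Nat.Properties as ℕ
  open import Data.Fin as F using (Fin; zero; suc; toℕ; fromℕ; inject₁)
  open import Data.Fin.Properties using (_≟_; _<?_; <-cmp; ≤-refl)
  open import Data.Vec as V using (Vec; []; _∷_; lookup)
  open import Data.List as L using (List; []; _∷_; allFin; filter; length)
  open import Data.List.Membership.Propositional using (_∈_)
  open import Data.List.Membership.Propositional.Properties using (∈-allFin)
  open import Data.List.Relation.Unary.Any using (here; there)
  open import Relation.Binary.PropositionalEquality as ≡ using (_≡_; _≢_; refl)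
  open import Relation.Binary.Definitions using (tri<; tri≈; tri>)
  open import Relation.Nullary using (Dec; yes; no; ¬_; does)
  open import Relation.Nullary.Decidable using (_×-dec_; ¬?; dec-true; dec-false)
  open import Relation.Unary using (Decidable)
  open import Data.Product using (∃; _×_; _,_; proj₁; proj₂)
  open import Data.Sum using (_⊎_; inj₁; inj₂)
  open import Data.Empty using (⊥-elim)
  open import Data.Bool using (false; if_then_else_; _∧_)
  import Defs
  open BigOperators
  open Enumeration using (CycleRep; cycleReps; cycleReps⁺-Unique; _≟ᶻ_)
  open PermutationSign using (injective⇒surjective; transpose-involutive; module Sign)
  open Cycles

  module _ {a p q} {A : Set a} {P : A → Set p} {Q : A → Set q} (P? : Decidable P) (Q? : Decidable Q) (Q⇒P : ∀ x → Q x → P x) where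

    length-filter-mono : ∀ xs → length (filter Q? xs) ℕ.≤ length (filter P? xs)
    length-filter-mono []       = ℕ.z≤n
    length-filter-mono (x ∷ xs) with P? x | Q? x
    ... | yes _  | yes _ = ℕ.s≤s (length-filter-mono xs)
    ... | yes _  | no _  = ℕ.m≤n⇒m≤1+n (length-filter-mono xs)
    ... | no ¬px | yes qx = ⊥-elim (¬px (Q⇒P x qx))
    ... | no _   | no _  = length-filter-mono xs

    length-filter-mono-< : ∀ xs {x₀} → x₀ ∈ xs → P x₀ → ¬ Q x₀ → length (filter Q? xs) ℕ.< length (filter P? xs)
    length-filter-mono-< (x ∷ xs) (here refl) px ¬qx with P? x | Q? x
    ... | yes _  | yes qx = ⊥-elim (¬qx qx)
    ... | yes _  | no _   = ℕ.s≤s (length-filter-mono xs)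
    ... | no ¬px | _      = ⊥-elim (¬px px)
    length-filter-mono-< (x ∷ xs) (there x₀∈) px ¬qx with P? x | Q? x
    ... | yes _  | yes _  = ℕ.s≤s (length-filter-mono-< xs x₀∈ px ¬qx)
    ... | yes _  | no _   = ℕ.m≤n⇒m≤1+n (length-filter-mono-< xs x₀∈ px ¬qx)
    ... | no ¬px | yes qx = ⊥-elim (¬px (Q⇒P x qx))
    ... | no _   | no _   = length-filter-mono-< xs x₀∈ px ¬qx

  all⊎leastCounterexample : ∀ {n p} {P : Fin n → Set p} → Decidable P →
                            (∀ x → P x) ⊎ ∃ λ m → ¬ P m × (∀ y → toℕ y ℕ.< toℕ m → P y)
  all⊎leastCounterexample {zero}  P? = inj₁ λ ()
  all⊎leastCounterexample {suc n} P? with P? zero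
  ... | no ¬p₀ = inj₂ (zero , ¬p₀ , λ _ ())
  ... | yes p₀ with all⊎leastCounterexample (P? ∘ suc)
  ...   | inj₁ all = inj₁ λ { zero → p₀ ; (suc x) → all x }
  ...   | inj₂ (m , ¬pm , below) = inj₂ (suc m , ¬pm , λ { zero _ → p₀ ; (suc y) y<m → below y (ℕ.≤-pred y<m) })

  module _ {ℓ₁ ℓ₂} (R : CommutativeRing ℓ₁ ℓ₂) where
    open CommutativeRing R hiding (zero) renaming (refl to ≈-refl)
    open import Algebra.Properties.Ring ring using (-1*x≈-x; -‿distribˡ-*)
    open Sign R using (sgn; sgn-cong; sgn-∘-transpose)
    open Big *-commutativeMonoid renaming (big to Π)
    open import Relation.Binary.Reasoning.Setoid setoid

    cycleWeight : ∀ {n} → CycleRep n → Carrier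
    cycleWeight (k , _) = Defs.negOnePow R k

    cycleSign : ∀ {n} → (Fin n → Fin n) → Carrier
    cycleSign {n} τ = Π (cycleReps n) (λ z → if does (isCycle? τ z) then cycleWeight z else 1#)

    record HasCycleDecomposition {n} (σ : Fin n → Fin n) : Set ℓ₂ where
      field
        sgn≈cycleSign : sgn σ ≈ cycleSign σ
        covered : ∀ v → ∃ λ z → IsCycle σ z × ∃ λ j → lookup (proj₂ z) j ≡ v

    open HasCycleDecomposition using (covered)

    private
      <-asym-does : ∀ {n} (i j : Fin n) → (does (i <? j) ∧ does (j <? i)) ≡ false
      <-asym-does i j with <-cmp i j
      ... | tri< i<j _ j≮i = ≡.cong₂ _∧_ (dec-true (i <? j) i<j) (dec-false (j <? i) j≮i)
      ... | tri≈ i≮j _ j≮i = ≡.cong₂ _∧_ (dec-false (i <? j) i≮j) (dec-false (j <? i) j≮i)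
      ... | tri> i≮j _ j<i = ≡.cong₂ _∧_ (dec-false (i <? j) i≮j) (dec-true (j <? i) j<i)

    identity-HasCycleDecomposition : ∀ {n} (τ : Fin n → Fin n) → (∀ x → τ x ≡ x) → HasCycleDecomposition τ
    identity-HasCycleDecomposition {n} τ fixed = record { sgn≈cycleSign = trans sgn≈1 (sym cycleSign≈1) ; covered = singleton }
      where
      sgn≈1 : sgn τ ≈ 1#
      sgn≈1 = big-ε (allFin n) λ {i} _ → big-ε (allFin n) λ {j} _ → reflexive
        (≡.trans (≡.cong₂ (λ u v → if does (i <? j) ∧ does (u <? v) then - 1# else 1#) (fixed j) (fixed i))
                 (≡.cong (if_then - 1# else 1#) (<-asym-does i j)))
      cycleSign≈1 : cycleSign τ ≈ 1#
      cycleSign≈1 = big-ε (cycleReps n) λ {z} _ → if-≈1 (isCycle? τ z)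
        where
        if-≈1 : ∀ {z} (d : Dec (IsCycle τ z)) → (if does d then cycleWeight z else 1#) ≈ 1#
        if-≈1 {k , zs} (yes c) = reflexive (≡.cong (Defs.negOnePow R) (fixed⇒singleton c zero (fixed _)))
        if-≈1           (no _) = ≈-refl
      singleton : ∀ v → ∃ λ z → IsCycle τ z × ∃ λ j → lookup (proj₂ z) j ≡ v
      singleton v = (0 , v ∷ []) , isCycle (λ { zero → ≡.sym (fixed v) }) (λ { zero zero _ → refl }) (λ { zero → ≤-refl }) , zero , refl

    nonFixedCount : ∀ {n} → (Fin n → Fin n) → ℕ
    nonFixedCount {n} τ = length (filter (λ x → ¬? (τ x ≟ x)) (allFin n))

    module InductionStep {n} (σ : Fin n → Fin n) (σ-inj : Injective _≡_ _≡_ σ) (m : Fin n) (σm≢m : σ m ≢ m)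
                (below : ∀ y → toℕ y ℕ.< toℕ m → σ y ≡ y) where

      least : ∀ x → σ x ≢ x → m F.≤ x
      least x σx≢x = ℕ.≮⇒≥ (σx≢x ∘ below x)

      p r : Fin n
      p = proj₁ (injective⇒surjective σ-inj m)
      r = proj₁ (injective⇒surjective σ-inj p)

      σp≡m : σ p ≡ m
      σp≡m = proj₂ (injective⇒surjective σ-inj m)

      σr≡p : σ r ≡ p
      σr≡p = proj₂ (injective⇒surjective σ-inj p)

      p≢m : p ≢ m
      p≢m p≡m = σm≢m (≡.subst (λ x → σ x ≡ m) p≡m σp≡m)

      open CutOut σ σ-inj σp≡m σr≡p p≢m least public

      fewerNonFixed : nonFixedCount σ′ ℕ.< nonFixedCount σ
      fewerNonFixed = length-filter-mono-< (λ x → ¬? (σ x ≟ x)) (λ x → ¬? (σ′ x ≟ x)) σ′-nonFixed⇒σ-nonFixed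
                        (allFin n) (∈-allFin p) σp≢p (λ σ′p≢p → σ′p≢p σ′p≡p)

      module _ (IH : HasCycleDecomposition σ′) where

        private
          Z′ : CycleRep n
          Z′ = proj₁ (covered IH r)
          Z′-cycle : IsCycle σ′ Z′
          Z′-cycle = proj₁ (proj₂ (covered IH r))

        lastOf-Z′ : lastOf Z′ ≡ r
        lastOf-Z′ with covered IH r
        ... | (k , zs) , c , j , zj≡r = ≡.trans (≡.cong (lookup zs) (≡.sym j≡last)) zj≡r
          where
          j≡last : j ≡ fromℕ k
          j≡last = returnsToHead⇒last c j (≡.trans (≡.cong σ′ zj≡r) (≡.trans σ′r≡m
                     (≡.sym (head≡leastNonFixed least′ c j (≡.trans (≡.cong σ′ zj≡r) σ′r≡m)))))

        sgn-σ : sgn σ ≈ - sgn σ′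
        sgn-σ = trans (sgn-cong (λ x → ≡.cong σ (≡.sym (transpose-involutive r p x)))) (sgn-∘-transpose σ′ σ′-injective r p r≢p)

        Q : CycleRep n → Set
        Q z = IsCycle σ′ z × lastOf z ≢ p

        Q? : ∀ z → Dec (Q z)
        Q? z = isCycle? σ′ z ×-dec ¬? (lastOf z ≟ p)

        weightσ weight′ weightσ′ : CycleRep n → Carrier
        weightσ  z = if does (isCycle? σ z) then cycleWeight z else 1#
        weight′  z = if does (Q? z) then (if does (lastOf z ≟ r) then - cycleWeight z else cycleWeight z) else 1#
        weightσ′ z = if does (Q? z) then cycleWeight z else 1#

        dropIfLast≡p extendIfLast≡r : CycleRep n → CycleRep n
        dropIfLast≡p   z = if does (lastOf z ≟ p) then shorten z else z
        extendIfLast≡r z = if does (lastOf z ≟ r) then extend z else z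

        private
          Q-Z′ : Q Z′
          Q-Z′ = Z′-cycle , λ last≡p → r≢p (≡.trans (≡.sym lastOf-Z′) last≡p)

          drop-extend : ∀ z → dropIfLast≡p (extend z) ≡ z
          drop-extend z = ≡.trans (if-yes (lastOf (extend z) ≟ p) (lastOf-extend z)) (shorten-extend z)

          extendIfLast≡r-yes : ∀ {z} → lastOf z ≡ r → extendIfLast≡r z ≡ extend z
          extendIfLast≡r-yes {z} = if-yes (lastOf z ≟ r)

          weight-extend : ∀ z → cycleWeight (extend z) ≈ - cycleWeight z
          weight-extend (k , _) = -1*x≈-x _

          To : CycleRep n → CycleRep n → Set ℓ₂
          To x z = z ∈ cycleReps n × Q z × extendIfLast≡r z ≡ x × weight′ z ≈ weightσ x

          to : ∀ {x} → x ∈ cycleReps n → IsCycle σ x → To x (dropIfLast≡p x)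
          to {x} _ = byLast (lastOf x ≟ p)
            where
            byLast : ∀ {x} → Dec (lastOf x ≡ p) → IsCycle σ x → To x (dropIfLast≡p x)
            byLast (yes last≡p) c with lastOf≡p⇒≡extend c last≡p
            ... | z , refl = ≡.subst (To (extend z)) (≡.sym (drop-extend z))
                               (IsCycle⇒∈cycleReps c′ , q , extendIfLast≡r-yes last≡r , weight≈)
              where
              c′,last≡r = shorten-IsCycle c
              c′ = proj₁ c′,last≡r
              last≡r = proj₂ c′,last≡r
              q : Q z
              q = c′ , λ last≡p → r≢p (≡.trans (≡.sym last≡r) last≡p)
              weight≈ : weight′ z ≈ weightσ (extend z)
              weight≈ = begin
                weight′ z               ≡⟨ ≡.trans (if-yes (Q? z) q) (if-yes (lastOf z ≟ r) last≡r) ⟩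
                - cycleWeight z         ≈⟨ weight-extend z ⟨
                cycleWeight (extend z)  ≡⟨ if-yes (isCycle? σ (extend z)) c ⟨
                weightσ (extend z)      ∎
            byLast {x} (no last≢p) c = ≡.subst (To x) (≡.sym (if-no (lastOf x ≟ p) last≢p))
              (IsCycle⇒∈cycleReps c′ , (c′ , last≢p) , if-no (lastOf x ≟ r) last≢r ,
               reflexive (≡.trans (≡.trans (if-yes (Q? x) (c′ , last≢p)) (if-no (lastOf x ≟ r) last≢r))
                                  (≡.sym (if-yes (isCycle? σ x) c))))
              where
              c′ = proj₁ (σ-cycle-untouched c last≢p)
              last≢r = proj₂ (σ-cycle-untouched c last≢p)

          From : CycleRep n → CycleRep n → Set
          From y z = z ∈ cycleReps n × IsCycle σ z × dropIfLast≡p z ≡ y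

          from : ∀ {y} → y ∈ cycleReps n → Q y → From y (extendIfLast≡r y)
          from {y} _ = byLast (lastOf y ≟ r)
            where
            byLast : ∀ {y} → Dec (lastOf y ≡ r) → Q y → From y (extendIfLast≡r y)
            byLast {y} (yes last≡r) (c′ , _) = ≡.subst (From y) (≡.sym (extendIfLast≡r-yes last≡r))
              (IsCycle⇒∈cycleReps c , c , drop-extend y)
              where c = extend-IsCycle c′ last≡r
            byLast {y} (no last≢r) (c′ , last≢p) = ≡.subst (From y) (≡.sym (if-no (lastOf y ≟ r) last≢r))
              (IsCycle⇒∈cycleReps c , c , if-no (lastOf y ≟ p) last≢p)
              where c = σ′-cycle-untouched c′ last≢p last≢r

        cycleSign-σ : cycleSign σ ≈ - cycleSign σ′
        cycleSign-σ = begin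
          cycleSign σ                                   ≈⟨ big-reindex (cycleReps n) (cycleReps n) unique unique (isCycle? σ) Q?
                                                             weightσ weight′ dropIfLast≡p extendIfLast≡r
                                                             (λ {x} _ ¬c → reflexive (if-no (isCycle? σ x) ¬c))
                                                             (λ {y} _ ¬q → reflexive (if-no (Q? y) ¬q)) to from ⟩
          Π (cycleReps n) weight′                       ≈⟨ big-extract _≟ᶻ_ (cycleReps n) unique Z′∈ ⟩
          weight′ Z′ * Π (cycleReps n) (except′ weight′) ≈⟨ *-cong weight′-Z′ (big-cong′ (cycleReps n) except-agree) ⟩
          - cycleWeight Z′ * Π (cycleReps n) (except′ weightσ′)   ≈⟨ -‿distribˡ-* _ _ ⟨
          - (cycleWeight Z′ * Π (cycleReps n) (except′ weightσ′)) ≈⟨ -‿cong (*-congʳ (reflexive (if-yes (Q? Z′) Q-Z′))) ⟨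
          - (weightσ′ Z′ * Π (cycleReps n) (except′ weightσ′))    ≈⟨ -‿cong (big-extract _≟ᶻ_ (cycleReps n) unique Z′∈) ⟨
          - Π (cycleReps n) weightσ′                    ≈⟨ -‿cong (big-cong′ (cycleReps n) weightσ′≈) ⟩
          - cycleSign σ′                                ∎
          where
          unique = cycleReps⁺-Unique n
          Z′∈ = IsCycle⇒∈cycleReps Z′-cycle
          except′ = except _≟ᶻ_ Z′
          weight′-Z′ : weight′ Z′ ≈ - cycleWeight Z′
          weight′-Z′ = reflexive (≡.trans (if-yes (Q? Z′) Q-Z′) (if-yes (lastOf Z′ ≟ r) lastOf-Z′))
          except-agree : ∀ z → except′ weight′ z ≈ except′ weightσ′ z
          except-agree z with z ≟ᶻ Z′
          ... | yes _ = ≈-refl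
          ... | no z≢Z′ = agree (Q? z)
            where
            agree : (q? : Dec (Q z)) → (if does q? then (if does (lastOf z ≟ r) then - cycleWeight z else cycleWeight z) else 1#)
                                       ≈ (if does q? then cycleWeight z else 1#)
            agree (yes (c , _)) = reflexive (if-no (lastOf z ≟ r) (λ last≡r → z≢Z′ (lastOf≡r-unique c Z′-cycle last≡r lastOf-Z′)))
            agree (no _) = ≈-refl
          weightσ′≈ : ∀ z → weightσ′ z ≈ (if does (isCycle? σ′ z) then cycleWeight z else 1#)
          weightσ′≈ z = byCycle (isCycle? σ′ z)
            where
            byCycle : (c? : Dec (IsCycle σ′ z)) → weightσ′ z ≈ (if does c? then cycleWeight z else 1#)
            byCycle (no ¬c) = reflexive (if-no (Q? z) (¬c ∘ proj₁))
            byCycle (yes c) = byLast (lastOf z ≟ p)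
              where
              byLast : Dec (lastOf z ≡ p) → weightσ′ z ≈ cycleWeight z
              byLast (yes last≡p) = reflexive (≡.trans (if-no (Q? z) (λ q → proj₂ q last≡p))
                                                       (≡.cong (Defs.negOnePow R) (≡.sym (lastOf≡p⇒singleton c last≡p))))
              byLast (no last≢p) = reflexive (if-yes (Q? z) (c , last≢p))

        covered-σ : ∀ v → ∃ λ z → IsCycle σ z × ∃ λ j → lookup (proj₂ z) j ≡ v
        covered-σ v with v ≟ p
        ... | yes refl = extend Z′ , extend-IsCycle Z′-cycle lastOf-Z′ , fromℕ _ , lookup-∷ʳ-fromℕ (proj₂ Z′) p
        ... | no v≢p with covered IH v
        ...   | z@(k , zs) , c , j , zj≡v with lastOf z ≟ r
        ...     | yes last≡r = extend z , extend-IsCycle c last≡r , inject₁ j , ≡.trans (lookup-∷ʳ-inject₁ zs p j) zj≡v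
        ...     | no last≢r with lastOf z ≟ p
        ...       | no last≢p = z , σ′-cycle-untouched c last≢p last≢r , j , zj≡v
        ...       | yes last≡p with lastOf≡p⇒singleton c last≡p
        ...         | refl with j
        ...           | zero = ⊥-elim (v≢p (≡.trans (≡.sym zj≡v) last≡p))

        hasCycleDecomposition-σ : HasCycleDecomposition σ
        hasCycleDecomposition-σ = record
          { sgn≈cycleSign = trans sgn-σ (trans (-‿cong (HasCycleDecomposition.sgn≈cycleSign IH)) (sym cycleSign-σ))
          ; covered = covered-σ
          }

    hasCycleDecomposition : ∀ N {n} (σ : Fin n → Fin n) → Injective _≡_ _≡_ σ → nonFixedCount σ ℕ.< N →
                            HasCycleDecomposition σ
    hasCycleDecomposition (suc N) σ σ-inj bound with all⊎leastCounterexample (λ x → σ x ≟ x)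
    ... | inj₁ fixed = identity-HasCycleDecomposition σ fixed
    ... | inj₂ (m , σm≢m , below) =
      hasCycleDecomposition-σ (hasCycleDecomposition N σ′ σ′-injective (ℕ.<-≤-trans fewerNonFixed (ℕ.≤-pred bound)))
      where open InductionStep σ σ-inj m σm≢m below

    sgn≈cycleSign : ∀ {n} (σ : Fin n → Fin n) → Injective _≡_ _≡_ σ → sgn σ ≈ cycleSign σ
    sgn≈cycleSign σ σ-inj = HasCycleDecomposition.sgn≈cycleSign (hasCycleDecomposition _ σ σ-inj (ℕ.n<1+n _))

module ConnectorSystems where

  open import Function using (_∘_)
  open import Function.Definitions using (Injective)
  open import Data.Nat using (ℕ)
  open import Data.Fin using (Fin)
  open import Data.Fin.Properties using (_≟_; any?; all?)
  open import Data.Vec as V using (Vec; lookup; tabulate)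
  import Data.Vec.Properties as V
  open import Data.List using (length)
  open import Data.List.Membership.Propositional using (_∈_)
  open import Data.List.Membership.Propositional.Properties using (∈-allFin; ∈-cartesianProduct⁺)
  open import Data.List.Relation.Unary.Unique.Propositional using (Unique)
  import Data.List.Relation.Unary.Any as Any
  open import Data.List.Relation.Unary.Any.Properties using (lookup-index)
  import Data.List.Relation.Unary.Unique.Propositional.Properties as Unique
  open import Data.Maybe as Maybe using (Maybe; just; nothing)
  open import Data.Bool using (Bool; true; false; if_then_else_; _∧_; not)
  open import Data.Bool.Properties using () renaming (_≟_ to _≟ᵇ_)
  open import Relation.Binary.PropositionalEquality as ≡ using (_≡_; _≢_; refl; cong; sym; trans)
  open import Relation.Nullary using (Dec; yes; no; ¬_; does)
  open import Relation.Nullary.Decidable using (_→-dec_; _×-dec_; dec-true; dec⇒maybe)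
  open import Data.Product using (∃; _×_; _,_; proj₁; proj₂)
  open import Data.Product.Properties using () renaming (≡-dec to ×-≡-dec)
  open import Data.Maybe.Properties using () renaming (≡-dec to Maybe-≡-dec)
  open import Data.Sum using (inj₁; inj₂)
  open import Data.Empty using (⊥-elim)
  open import Data.Unit using (tt)
  open import Defs
  open PermutationSign using (injective⇒surjective)
  open Cycles using (lookup-ext)
  open Enumeration using (∈-vecs; vecs⁺-Unique; ∈-bools; bools⁺-Unique; ∈-maybes; maybes⁺-Unique; lookup-injective)

  indicator : ∀ {k p} {P : Fin k → Set p} → (∀ i → Dec (P i)) → Vec Bool k
  indicator P? = tabulate (does ∘ P?)

  module _ {k p} {P : Fin k → Set p} (P? : ∀ i → Dec (P i)) where

    indicator⁻ : ∀ i → lookup (indicator P?) i ≡ true → P i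
    indicator⁻ i eq = go (P? i) (trans (sym (V.lookup∘tabulate (does ∘ P?) i)) eq)
      where
      go : (d : Dec (P i)) → does d ≡ true → P i
      go (yes p) _ = p

    indicator⁺ : ∀ i → P i → lookup (indicator P?) i ≡ true
    indicator⁺ i p = trans (V.lookup∘tabulate (does ∘ P?) i) (dec-true (P? i) p)

  Bool-≡ : ∀ {a b : Bool} → (a ≡ true → b ≡ true) → (b ≡ true → a ≡ true) → a ≡ b
  Bool-≡ {true}  {true}  _ _ = refl
  Bool-≡ {true}  {false} f _ = sym (f refl)
  Bool-≡ {false} {true}  _ g = g refl
  Bool-≡ {false} {false} _ _ = refl

  ≢true⇒≡false : ∀ {b : Bool} → b ≢ true → b ≡ false
  ≢true⇒≡false {true}  b≢true = ⊥-elim (b≢true refl)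
  ≢true⇒≡false {false} _      = refl

  module _ {n m : ℕ} (E : Fin m → Fin 4 → Fin n) where

    -- G v is meant to be the connector at v; its blue hyperedge is the one with last vertex v.
    record IsConnectorSystem (G : Fin n → Vec (Fin m) 4) : Set where
      field
        isConnector : ∀ v → IsConnector E (G v) v
        consistent  : ∀ v i → lookup (G (E (lookup (G v) blue) i)) i ≡ lookup (G v) blue

    closed? : ∀ S X Y → Dec (Closed E S X Y)
    closed? S X Y = all? (λ h → inS? E S h →-dec all? (λ i → lookup X h ≟ᵇ lookup Y (E h i)))

    module Components (G : Fin n → Vec (Fin m) 4) where

      α : Fin 4 → Fin n → Fin n
      α i v = E (lookup (G v) blue) i

      Used : Fin m → Set
      Used h = ∃ λ v → lookup (G v) blue ≡ h

      used? : ∀ h → Dec (Used h)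
      used? h = any? (λ v → lookup (G v) blue ≟ h)

      usedEdges : Vec Bool m
      usedEdges = indicator used?

      -- The weak component of h₀ in O(usedEdges) is the least closed set of nodes containing h₀.
      InComponentᵉ : Fin m → Fin m → Set
      InComponentᵉ h₀ h = ∀ X Y → Closed E usedEdges X Y → lookup X h₀ ≡ true → lookup X h ≡ true

      InComponentᵛ : Fin m → Fin n → Set
      InComponentᵛ h₀ v = ∀ X Y → Closed E usedEdges X Y → lookup X h₀ ≡ true → lookup Y v ≡ true

      inComponentᵉ? : ∀ h₀ h → Dec (InComponentᵉ h₀ h)
      inComponentᵉ? h₀ h = allBools? m λ X → allBools? n λ Y →
        closed? usedEdges X Y →-dec ((lookup X h₀ ≟ᵇ true) →-dec (lookup X h ≟ᵇ true))

      inComponentᵛ? : ∀ h₀ v → Dec (InComponentᵛ h₀ v)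
      inComponentᵛ? h₀ v = allBools? m λ X → allBools? n λ Y →
        closed? usedEdges X Y →-dec ((lookup X h₀ ≟ᵇ true) →-dec (lookup Y v ≟ᵇ true))

      componentEdges : Fin m → Vec Bool m
      componentEdges h₀ = indicator (inComponentᵉ? h₀)

      componentVertices : Fin m → Vec Bool n
      componentVertices h₀ = indicator (inComponentᵛ? h₀)

      componentConnectors : Fin m → Vec (Maybe (Vec (Fin m) 4)) n
      componentConnectors h₀ = tabulate (λ v → if lookup (componentVertices h₀) v then just (G v) else nothing)

      component : Fin m → Circ n m
      component h₀ = componentEdges h₀ , componentConnectors h₀

    module Properties {G : Fin n → Vec (Fin m) 4} (cs : IsConnectorSystem G) where
      open IsConnectorSystem cs public
      open Components G public

      α-injective : ∀ i → Injective _≡_ _≡_ (α i)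
      α-injective i {v} {w} αv≡αw = trans (sym (isConnector v blue)) (trans (cong (λ h → E h blue) same-edge) (isConnector w blue))
        where same-edge = trans (sym (consistent v i)) (trans (cong (λ u → lookup (G u) i) αv≡αw) (consistent w i))

      connectorEdge-blue : ∀ v i → lookup (G (E (lookup (G v) i) blue)) blue ≡ lookup (G v) i
      connectorEdge-blue v i = trans (cong (λ w → lookup (G w) blue) E≡u) (sym h≡)
        where
        u = proj₁ (injective⇒surjective (α-injective i) v)
        αu≡v : α i u ≡ v
        αu≡v = proj₂ (injective⇒surjective (α-injective i) v)
        h≡ : lookup (G v) i ≡ lookup (G u) blue
        h≡ = trans (cong (λ w → lookup (G w) i) (sym αu≡v)) (consistent u i)
        E≡u : E (lookup (G v) i) blue ≡ u
        E≡u = trans (cong (λ h → E h blue) h≡) (isConnector u blue)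

      Used-connectorEdge : ∀ v i → Used (lookup (G v) i)
      Used-connectorEdge v i = _ , connectorEdge-blue v i

      Used-consistent : ∀ {h} → Used h → ∀ i → lookup (G (E h i)) i ≡ h
      Used-consistent (u , refl) = consistent u

      ∈usedEdges⇒Used : ∀ {h} → InS E usedEdges h → Used h
      ∈usedEdges⇒Used {h} = indicator⁻ used? h

      Used⇒∈usedEdges : ∀ {h} → Used h → InS E usedEdges h
      Used⇒∈usedEdges {h} = indicator⁺ used? h

      component-minimalᵉ : ∀ h₀ X Y → Closed E usedEdges X Y → lookup X h₀ ≡ true →
                           ∀ h → lookup (componentEdges h₀) h ≡ true → lookup X h ≡ true
      component-minimalᵉ h₀ X Y closed X-h₀ h h∈ = indicator⁻ (inComponentᵉ? h₀) h h∈ X Y closed X-h₀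

      component-minimalᵛ : ∀ h₀ X Y → Closed E usedEdges X Y → lookup X h₀ ≡ true →
                           ∀ v → lookup (componentVertices h₀) v ≡ true → lookup Y v ≡ true
      component-minimalᵛ h₀ X Y closed X-h₀ v v∈ = indicator⁻ (inComponentᵛ? h₀) v v∈ X Y closed X-h₀

      component-edge≡vertex : ∀ h₀ h → Used h → ∀ i → lookup (componentEdges h₀) h ≡ lookup (componentVertices h₀) (E h i)
      component-edge≡vertex h₀ h used i = Bool-≡
        (λ h∈ → indicator⁺ (inComponentᵛ? h₀) _ λ X Y closed X-h₀ →
                  trans (sym (closed h (Used⇒∈usedEdges used) i)) (indicator⁻ (inComponentᵉ? h₀) h h∈ X Y closed X-h₀))
        (λ v∈ → indicator⁺ (inComponentᵉ? h₀) _ λ X Y closed X-h₀ →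
                  trans (closed h (Used⇒∈usedEdges used) i) (indicator⁻ (inComponentᵛ? h₀) _ v∈ X Y closed X-h₀))

      component-Closed : ∀ h₀ → Closed E usedEdges (componentEdges h₀) (componentVertices h₀)
      component-Closed h₀ h h∈ = component-edge≡vertex h₀ h (∈usedEdges⇒Used h∈)

      component-self : ∀ h₀ → lookup (componentEdges h₀) h₀ ≡ true
      component-self h₀ = indicator⁺ (inComponentᵉ? h₀) h₀ (λ _ _ _ X-h₀ → X-h₀)

      component⊆Used : ∀ h₀ → Used h₀ → ∀ h → lookup (componentEdges h₀) h ≡ true → Used h
      component⊆Used h₀ used h h∈ = ∈usedEdges⇒Used (component-minimalᵉ h₀ usedEdges everything
        (λ h′ h′∈ i → trans h′∈ (sym (V.lookup-replicate (E h′ i) true))) (Used⇒∈usedEdges used) h h∈)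
        where everything = V.replicate n true

      componentVertex≡componentEdge : ∀ h₀ v → lookup (componentVertices h₀) v ≡ lookup (componentEdges h₀) (lookup (G v) blue)
      componentVertex≡componentEdge h₀ v =
        trans (cong (lookup (componentVertices h₀)) (sym (isConnector v blue))) (sym (component-edge≡vertex h₀ _ (v , refl) blue))

      module _ (h₀ : Fin m) (used₀ : Used h₀) where
        private
          Cᵉ = componentEdges h₀
          Cᵛ = componentVertices h₀

        -- Intersecting a closed set (X , Y) with the component gives a closed set of O(usedEdges),
        -- which by minimality contains the whole component.
        closed∋h₀⇒⊇component : ∀ X Y → Closed E Cᵉ X Y → lookup X h₀ ≡ true → AllNodes E true Cᵉ X Y
        closed∋h₀⇒⊇component X Y closed X-h₀ h h∈ =
          ∧-true-right (trans (sym (lookup-X′ h)) (component-minimalᵉ h₀ X′ Y′ closed′ X′-h₀ h h∈)) ,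
          λ i → ∧-true-right (trans (sym (lookup-Y′ _)) (component-minimalᵛ h₀ X′ Y′ closed′ X′-h₀ _
                  (trans (sym (component-edge≡vertex h₀ h (component⊆Used h₀ used₀ h h∈) i)) h∈)))
          where
          X′ = V.zipWith _∧_ Cᵉ X
          Y′ = V.zipWith _∧_ Cᵛ Y
          lookup-X′ : ∀ h → lookup X′ h ≡ lookup Cᵉ h ∧ lookup X h
          lookup-X′ h = V.lookup-zipWith _∧_ h Cᵉ X
          lookup-Y′ : ∀ v → lookup Y′ v ≡ lookup Cᵛ v ∧ lookup Y v
          lookup-Y′ v = V.lookup-zipWith _∧_ v Cᵛ Y
          ∧-true-right : ∀ {a b} → a ∧ b ≡ true → b ≡ true
          ∧-true-right {true} eq = eq
          closed′ : Closed E usedEdges X′ Y′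
          closed′ h h-used i = trans (lookup-X′ h) (trans (by-membership (lookup Cᵉ h) refl) (sym (lookup-Y′ _)))
            where
            Cᵉ≡Cᵛ = component-edge≡vertex h₀ h (∈usedEdges⇒Used h-used) i
            by-membership : ∀ b → lookup Cᵉ h ≡ b → b ∧ lookup X h ≡ lookup Cᵛ (E h i) ∧ lookup Y (E h i)
            by-membership true  h∈ = trans (closed h h∈ i) (sym (cong (_∧ lookup Y (E h i)) (trans (sym Cᵉ≡Cᵛ) h∈)))
            by-membership false h∉ = sym (cong (_∧ lookup Y (E h i)) (trans (sym Cᵉ≡Cᵛ) h∉))
          X′-h₀ : lookup X′ h₀ ≡ true
          X′-h₀ = trans (lookup-X′ h₀) (≡.cong₂ _∧_ (component-self h₀) X-h₀)

        component-WeaklyConnected : WeaklyConnected E Cᵉ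
        component-WeaklyConnected = (h₀ , component-self h₀) , split
          where
          split : ∀ X Y → Closed E Cᵉ X Y → AllNodes E true Cᵉ X Y Data.Sum.⊎ AllNodes E false Cᵉ X Y
          split X Y closed with lookup X h₀ in X-h₀
          ... | true  = inj₁ (closed∋h₀⇒⊇component X Y closed X-h₀)
          ... | false = inj₂ (negate (closed∋h₀⇒⊇component (V.map not X) (V.map not Y) closed-not
                                       (trans (V.lookup-map h₀ not X) (cong not X-h₀))))
            where
            closed-not : Closed E Cᵉ (V.map not X) (V.map not Y)
            closed-not h h∈ i = trans (V.lookup-map h not X) (trans (cong not (closed h h∈ i)) (sym (V.lookup-map (E h i) not Y)))
            not-true : ∀ {b} → not b ≡ true → b ≡ false
            not-true {false} _ = refl
            negate : AllNodes E true Cᵉ (V.map not X) (V.map not Y) → AllNodes E false Cᵉ X Y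
            negate all h h∈ = not-true (trans (sym (V.lookup-map h not X)) (proj₁ (all h h∈))) ,
                              λ i → not-true (trans (sym (V.lookup-map (E h i) not Y)) (proj₂ (all h h∈) i))

      componentConnectors-lookup : ∀ h₀ v → lookup (componentVertices h₀) v ≡ true → lookup (componentConnectors h₀) v ≡ just (G v)
      componentConnectors-lookup h₀ v v∈ =
        trans (V.lookup∘tabulate (λ w → if lookup (componentVertices h₀) w then just (G w) else nothing) v)
              (cong (if_then just (G v) else nothing) v∈)

      componentConnectors-just : ∀ h₀ v {t} → lookup (componentConnectors h₀) v ≡ just t →
                                 lookup (componentVertices h₀) v ≡ true × G v ≡ t
      componentConnectors-just h₀ v {t} eq =
        by-membership (lookup (componentVertices h₀) v)
          (trans (sym (V.lookup∘tabulate (λ w → if lookup (componentVertices h₀) w then just (G w) else nothing) v)) eq)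
        where
        by-membership : ∀ b → (if b then just (G v) else nothing) ≡ just t → b ≡ true × G v ≡ t
        by-membership true refl = refl , refl

      LiesIn⇒∈componentVertices : ∀ h₀ v → LiesIn E v (componentConnectors h₀) → lookup (componentVertices h₀) v ≡ true
      LiesIn⇒∈componentVertices h₀ v (_ , eq , _) = proj₁ (componentConnectors-just h₀ v eq)

      ∈componentVertices⇒LiesIn : ∀ h₀ v → lookup (componentVertices h₀) v ≡ true → LiesIn E v (componentConnectors h₀)
      ∈componentVertices⇒LiesIn h₀ v v∈ = G v , componentConnectors-lookup h₀ v v∈ , tt

      component-IsCircuit : ∀ h₀ → Used h₀ → IsCircuit E (component h₀)
      component-IsCircuit h₀ used₀ = connectors , exactlyOne , edges∈ , component-WeaklyConnected h₀ used₀
        where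
        connectors : ∀ v t → Conn E (componentConnectors h₀) v t → IsConnector E t v
        connectors v t eq i = ≡.subst (λ t′ → E (lookup t′ i) i ≡ v) (proj₂ (componentConnectors-just h₀ v eq)) (isConnector v i)
        exactlyOne : ∀ h → InS E (componentEdges h₀) h → ∀ i →
                     ExactlyOne (λ v → ∃ λ t → Conn E (componentConnectors h₀) v t × lookup t i ≡ h)
        exactlyOne h h∈ i = E h i , (G (E h i) , componentConnectors-lookup h₀ (E h i) Ehi∈ , Used-consistent used i) , unique
          where
          used = component⊆Used h₀ used₀ h h∈
          Ehi∈ = trans (sym (component-edge≡vertex h₀ h used i)) h∈
          unique : ∀ w → (∃ λ t → Conn E (componentConnectors h₀) w t × lookup t i ≡ h) → E h i ≡ w
          unique w (t , eq , ti≡h) = trans (cong (λ h′ → E h′ i) (sym ti≡h))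
            (trans (cong (λ t′ → E (lookup t′ i) i) (sym (proj₂ (componentConnectors-just h₀ w eq)))) (isConnector w i))
        edges∈ : ∀ v t → Conn E (componentConnectors h₀) v t → ∀ i → InS E (componentEdges h₀) (lookup t i)
        edges∈ v t eq i with componentConnectors-just h₀ v eq
        ... | v∈ , refl = trans (component-edge≡vertex h₀ _ (Used-connectorEdge v i) i)
                                (trans (cong (lookup (componentVertices h₀)) (isConnector v i)) v∈)

      component-cong : ∀ h₀ → Used h₀ → ∀ h₁ → Used h₁ → lookup (componentEdges h₀) h₁ ≡ true → component h₀ ≡ component h₁
      component-cong h₀ used₀ h₁ used₁ h₁∈ = ≡.cong₂ _,_ edges≡ connectors≡
        where
        closed₁ : Closed E (componentEdges h₀) (componentEdges h₁) (componentVertices h₁)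
        closed₁ h h∈ = component-Closed h₁ h (Used⇒∈usedEdges (component⊆Used h₀ used₀ h h∈))
        h₀∈ : lookup (componentEdges h₁) h₀ ≡ true
        h₀∈ with proj₂ (component-WeaklyConnected h₀ used₀) (componentEdges h₁) (componentVertices h₁) closed₁
        ... | inj₁ all  = proj₁ (all h₀ (component-self h₀))
        ... | inj₂ none = ⊥-elim (false≢true (trans (sym (proj₁ (none h₁ h₁∈))) (component-self h₁)))
          where false≢true : false ≢ true
                false≢true ()
        edges≡ : componentEdges h₀ ≡ componentEdges h₁
        edges≡ = lookup-ext λ h → Bool-≡
          (component-minimalᵉ h₀ (componentEdges h₁) (componentVertices h₁) (component-Closed h₁) h₀∈ h)
          (component-minimalᵉ h₁ (componentEdges h₀) (componentVertices h₀) (component-Closed h₀) h₁∈ h)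
        vertices≡ : ∀ v → lookup (componentVertices h₀) v ≡ lookup (componentVertices h₁) v
        vertices≡ v = Bool-≡ (component-minimalᵛ h₀ (componentEdges h₁) (componentVertices h₁) (component-Closed h₁) h₀∈ v)
                            (component-minimalᵛ h₁ (componentEdges h₀) (componentVertices h₀) (component-Closed h₀) h₁∈ v)
        connectors≡ : componentConnectors h₀ ≡ componentConnectors h₁
        connectors≡ = V.tabulate-cong (λ v → cong (if_then just (G v) else nothing) (vertices≡ v))

      component-unique : ∀ h₀ h₁ → Used h₀ → Used h₁ → ∀ v →
                         LiesIn E v (componentConnectors h₀) → LiesIn E v (componentConnectors h₁) → component h₀ ≡ component h₁
      component-unique h₀ h₁ used₀ used₁ v v∈₀ v∈₁ =
        trans (component-cong h₀ used₀ h (v , refl) (trans (sym (componentVertex≡componentEdge h₀ v)) (LiesIn⇒∈componentVertices h₀ v v∈₀)))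
          (sym (component-cong h₁ used₁ h (v , refl) (trans (sym (componentVertex≡componentEdge h₁ v)) (LiesIn⇒∈componentVertices h₁ v v∈₁))))
        where h = lookup (G v) blue

    ∈-allCircs : ∀ c → c ∈ allCircs E
    ∈-allCircs (S , C) = ∈-cartesianProduct⁺ (∈-vecs ∈-bools S) (∈-vecs (∈-maybes (∈-vecs ∈-allFin)) C)

    allCircs⁺-Unique : Unique (allCircs E)
    allCircs⁺-Unique = Unique.cartesianProduct⁺ (vecs⁺-Unique bools⁺-Unique m)
                         (vecs⁺-Unique (maybes⁺-Unique (vecs⁺-Unique (Unique.allFin⁺ m) 4)) n)

    _≟ᶜ_ : (c c′ : Circ n m) → Dec (c ≡ c′)
    _≟ᶜ_ = ×-≡-dec (V.≡-dec _≟ᵇ_) (V.≡-dec (Maybe-≡-dec (V.≡-dec _≟_)))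

    circ-injective : ∀ j j′ → circ E j ≡ circ E j′ → j ≡ j′
    circ-injective = lookup-injective allCircs⁺-Unique

    indexOf : Circ n m → Fin (length (allCircs E))
    indexOf c = Any.index (∈-allCircs c)

    circ-indexOf : ∀ c → circ E (indexOf c) ≡ c
    circ-indexOf c = sym (lookup-index (∈-allCircs c))

    module _ (G : Fin n → Vec (Fin m) 4) where
      open Components G

      IsComponent : Fin (length (allCircs E)) → Set
      IsComponent j = ∃ λ v → circ E j ≡ component (lookup (G v) blue)

      isComponent? : ∀ j → Dec (IsComponent j)
      isComponent? j = any? (λ v → circ E j ≟ᶜ component (lookup (G v) blue))

      circuitsOf : CircSet E
      circuitsOf = indicator isComponent?

    module _ {G : Fin n → Vec (Fin m) 4} (cs : IsConnectorSystem G) where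
      open Properties cs

      component∈circuitsOf : ∀ v → Member E (circuitsOf G) (indexOf (component (lookup (G v) blue)))
      component∈circuitsOf v = indicator⁺ (isComponent? G) _ (v , circ-indexOf _)

      circuitsOf-IsCircuitPartition : IsCircuitPartition E (circuitsOf G)
      circuitsOf-IsCircuitPartition = circuits , disjoint , covering
        where
        circuits : ∀ j → Member E (circuitsOf G) j → IsCircuit E (circ E j)
        circuits j j∈ with indicator⁻ (isComponent? G) j j∈
        ... | v , eq = ≡.subst (IsCircuit E) (sym eq) (component-IsCircuit _ (v , refl))
        disjoint : ∀ j j′ → Member E (circuitsOf G) j → Member E (circuitsOf G) j′ → j ≢ j′ →
                   ∀ v → ¬ (LiesIn E v (connsOf E j) × LiesIn E v (connsOf E j′))
        disjoint j j′ j∈ j′∈ j≢j′ v (v∈ , v∈′) with indicator⁻ (isComponent? G) j j∈ | indicator⁻ (isComponent? G) j′ j′∈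
        ... | w , eq | w′ , eq′ = j≢j′ (circ-injective j j′ (trans eq (trans (component-unique _ _ (w , refl) (w′ , refl) v
                (≡.subst (LiesIn E v) (cong proj₂ eq) v∈) (≡.subst (LiesIn E v) (cong proj₂ eq′) v∈′)) (sym eq′))))
        covering : ∀ v → ∃ λ j → Member E (circuitsOf G) j × LiesIn E v (connsOf E j)
        covering v = _ , component∈circuitsOf v , ≡.subst (LiesIn E v) (sym (cong proj₂ (circ-indexOf _)))
          (∈componentVertices⇒LiesIn _ v (trans (componentVertex≡componentEdge _ v) (component-self _)))

    -- d is an arbitrary hyperedge, used only where P does not cover v.
    module ConnectorsOf (d : Fin m) where

      Covers : CircSet E → Fin n → Fin (length (allCircs E)) → Set
      Covers P v j = Member E P j × LiesIn E v (connsOf E j)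

      covers? : ∀ P v j → Dec (Covers P v j)
      covers? P v j = (lookup P j ≟ᵇ true) ×-dec liesIn? E v (connsOf E j)

      connectorOr-d : Maybe (Maybe (Vec (Fin m) 4)) → Vec (Fin m) 4
      connectorOr-d (just (just t)) = t
      connectorOr-d _               = V.replicate 4 d

      -- opaque, so that the type checker never tries to evaluate the search over all circuits
      opaque
        connectorsOf : CircSet E → Fin n → Vec (Fin m) 4
        connectorsOf P v = connectorOr-d (Maybe.map (λ j → lookup (connsOf E j) v) (Maybe.map proj₁ (dec⇒maybe (any? (covers? P v)))))

        connectorsOf-≡ : ∀ P v j {t} → (∀ j′ → Covers P v j′ → j′ ≡ j) → Covers P v j → lookup (connsOf E j) v ≡ just t →
                         connectorsOf P v ≡ t
        connectorsOf-≡ P v j unique covers eq with any? (covers? P v)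
        ... | yes (j′ , covers′) rewrite unique j′ covers′ = cong connectorOr-d (cong just eq)
        ... | no none = ⊥-elim (none (j , covers))

      module _ {P : CircSet E} (partition : IsCircuitPartition E P) where
        private
          circuits = proj₁ partition
          disjoint = proj₁ (proj₂ partition)
          covering = proj₂ (proj₂ partition)
          G = connectorsOf P

        Covers-unique : ∀ v j j′ → Covers P v j → Covers P v j′ → j′ ≡ j
        Covers-unique v j j′ (j∈ , v∈) (j′∈ , v∈′) with j′ ≟ j
        ... | yes j′≡j = j′≡j
        ... | no j′≢j = ⊥-elim (disjoint j′ j j′∈ j∈ j′≢j v (v∈′ , v∈))

        connectorsOf-Conn : ∀ v j {t} → Member E P j → Conn E (connsOf E j) v t → G v ≡ t
        connectorsOf-Conn v j {t} j∈ eq = connectorsOf-≡ P v j (λ j′ → Covers-unique v j j′ covers) covers eq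
          where covers = j∈ , t , eq , tt

        connectorsOf-covering : ∀ v → ∃ λ j → Member E P j × Conn E (connsOf E j) v (G v)
        connectorsOf-covering v with covering v
        ... | j , j∈ , t , eq , _ = j , j∈ , trans eq (cong just (sym (connectorsOf-Conn v j j∈ eq)))

        connectorsOf-IsConnectorSystem : IsConnectorSystem G
        connectorsOf-IsConnectorSystem = record { isConnector = isConnector′ ; consistent = consistent′ }
          where
          isConnector′ : ∀ v → IsConnector E (G v) v
          isConnector′ v with connectorsOf-covering v
          ... | j , j∈ , eq = proj₁ (circuits j j∈) v (G v) eq
          consistent′ : ∀ v i → lookup (G (E (lookup (G v) blue) i)) i ≡ lookup (G v) blue
          consistent′ v i with connectorsOf-covering v
          ... | j , j∈ , eq with proj₁ (proj₂ (circuits j j∈)) (lookup (G v) blue) (proj₁ (proj₂ (proj₂ (circuits j j∈))) v (G v) eq blue) i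
          ...   | w , (t , eq′ , ti≡h) , _ =
            trans (cong (λ x → lookup (G x) i) Ehi≡w) (trans (cong (λ t → lookup t i) (connectorsOf-Conn w j j∈ eq′)) ti≡h)
            where
            Ehi≡w : E (lookup (G v) blue) i ≡ w
            Ehi≡w = trans (cong (λ h → E h i) (sym ti≡h)) (proj₁ (circuits j j∈) w t eq′ i)

        module _ {G′ : Fin n → Vec (Fin m) 4} (cs′ : IsConnectorSystem G′) (G′≗G : ∀ v → G′ v ≡ G v) where
          open Properties cs′

          private
            G′-Conn : ∀ w j {t} → Member E P j → Conn E (connsOf E j) w t → G′ w ≡ t
            G′-Conn w j j∈ eq = trans (G′≗G w) (connectorsOf-Conn w j j∈ eq)

            circuitEdge-Used : ∀ j → Member E P j → ∀ h → InS E (proj₁ (circ E j)) h → Used h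
            circuitEdge-Used j j∈ h h∈ with proj₁ (proj₂ (circuits j j∈)) h h∈ blue
            ... | w , (t , eq , t₃≡h) , _ = w , trans (cong (λ t → lookup t blue) (G′-Conn w j j∈ eq)) t₃≡h

            circuitEdge-LiesIn : ∀ j → Member E P j → ∀ h → InS E (proj₁ (circ E j)) h → ∀ i → LiesIn E (E h i) (connsOf E j)
            circuitEdge-LiesIn j j∈ h h∈ i with proj₁ (proj₂ (circuits j j∈)) h h∈ i
            ... | w , (t , eq , tᵢ≡h) , _ = ≡.subst (λ x → LiesIn E x (connsOf E j))
                (sym (trans (cong (λ h → E h i) (sym tᵢ≡h)) (proj₁ (circuits j j∈) w t eq i))) (t , eq , tt)

          circuit≡component : ∀ j → Member E P j → ∀ {h₀} → InS E (proj₁ (circ E j)) h₀ → circ E j ≡ component h₀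
          circuit≡component j j∈ {h₀} h₀∈ = ≡.cong₂ _,_ edges≡ connectors≡
            where
            S = proj₁ (circ E j)
            C = connsOf E j
            edges∈S = proj₁ (proj₂ (proj₂ (circuits j j∈)))
            S⊆component : ∀ h → lookup S h ≡ true → lookup (componentEdges h₀) h ≡ true
            S⊆component h h∈ with proj₂ (proj₂ (proj₂ (proj₂ (circuits j j∈)))) (componentEdges h₀) (componentVertices h₀)
                                   (λ h′ h′∈ → component-Closed h₀ h′ (Used⇒∈usedEdges (circuitEdge-Used j j∈ h′ h′∈)))
            ... | inj₁ all  = proj₁ (all h h∈)
            ... | inj₂ none = ⊥-elim (false≢true (trans (sym (proj₁ (none h₀ h₀∈))) (component-self h₀)))
              where false≢true : false ≢ true
                    false≢true ()
            Cᵛ = indicator (λ w → liesIn? E w C)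
            closed : Closed E usedEdges S Cᵛ
            closed h h-used i = Bool-≡
              (λ h∈ → indicator⁺ (λ w → liesIn? E w C) _ (circuitEdge-LiesIn j j∈ h h∈ i))
              (λ v∈ → let (t , eq , _) = indicator⁻ (λ w → liesIn? E w C) _ v∈
                          tᵢ≡h = trans (cong (λ t → lookup t i) (sym (G′-Conn (E h i) j j∈ eq))) (Used-consistent (∈usedEdges⇒Used h-used) i)
                      in ≡.subst (InS E S) tᵢ≡h (edges∈S (E h i) t eq i))
            component⊆S : ∀ h → lookup (componentEdges h₀) h ≡ true → lookup S h ≡ true
            component⊆S = component-minimalᵉ h₀ S Cᵛ closed h₀∈
            edges≡ : S ≡ componentEdges h₀
            edges≡ = lookup-ext (λ h → Bool-≡ (S⊆component h) (component⊆S h))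
            connectors≡ : C ≡ componentConnectors h₀
            connectors≡ = lookup-ext pointwise
              where
              pointwise : ∀ w → lookup C w ≡ lookup (componentConnectors h₀) w
              pointwise w with lookup C w in eq
              ... | just t = trans (cong just (sym G′w≡t)) (sym (componentConnectors-lookup h₀ w
                               (trans (componentVertex≡componentEdge h₀ w) (S⊆component _ blue∈S))))
                where
                G′w≡t = G′-Conn w j j∈ eq
                blue∈S : lookup S (lookup (G′ w) blue) ≡ true
                blue∈S = ≡.subst (λ t → lookup S (lookup t blue) ≡ true) (sym G′w≡t) (edges∈S w t eq blue)
              ... | nothing = sym (trans (V.lookup∘tabulate (λ w → if lookup (componentVertices h₀) w then just (G′ w) else nothing) w)
                                    (cong (if_then just (G′ w) else nothing) w∉))
                where
                w∉ : lookup (componentVertices h₀) w ≡ false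
                w∉ = ≢true⇒≡false λ w∈ →
                  let (t , eq′ , _) = ≡.subst (λ x → LiesIn E x C) (isConnector w blue)
                        (circuitEdge-LiesIn j j∈ _ (component⊆S _ (trans (sym (componentVertex≡componentEdge h₀ w)) w∈)) blue)
                  in nothing≢just (trans (sym eq) eq′)
                  where nothing≢just : ∀ {t} → nothing ≢ just t
                        nothing≢just ()

          circuitsOf≡ : circuitsOf G′ ≡ P
          circuitsOf≡ = lookup-ext (λ j → Bool-≡ (⊆P j) (P⊆ j))
            where
            ⊆P : ∀ j → lookup (circuitsOf G′) j ≡ true → lookup P j ≡ true
            ⊆P j j∈ with indicator⁻ (isComponent? G′) j j∈
            ... | v , eq with connectorsOf-covering v
            ...   | j₁ , j₁∈ , eq₁ =
              let blue∈ : InS E (proj₁ (circ E j₁)) (lookup (G′ v) blue)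
                  blue∈ = ≡.subst (λ t → InS E (proj₁ (circ E j₁)) (lookup t blue)) (sym (G′≗G v))
                            (proj₁ (proj₂ (proj₂ (circuits j₁ j₁∈))) v (G v) eq₁ blue)
              in ≡.subst (λ x → lookup P x ≡ true) (sym (circ-injective j j₁ (trans eq (sym (circuit≡component j₁ j₁∈ blue∈))))) j₁∈
            P⊆ : ∀ j → lookup P j ≡ true → lookup (circuitsOf G′) j ≡ true
            P⊆ j j∈ with proj₁ (proj₂ (proj₂ (proj₂ (circuits j j∈))))
            ... | h₀ , h₀∈ with proj₁ (proj₂ (circuits j j∈)) h₀ h₀∈ blue
            ...   | w , (t , eq , t₃≡h₀) , _ = indicator⁺ (isComponent? G′) j
                    (w , trans (circuit≡component j j∈ h₀∈) (cong component (sym (trans (cong (λ t → lookup t blue) (G′-Conn w j j∈ eq)) t₃≡h₀))))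

      connectorsOf-circuitsOf : ∀ {G} (cs : IsConnectorSystem G) v → connectorsOf (circuitsOf G) v ≡ G v
      connectorsOf-circuitsOf {G} cs v =
        connectorsOf-Conn {P = circuitsOf G} (circuitsOf-IsCircuitPartition cs) v (indexOf (component h)) (component∈circuitsOf cs v)
        (trans (cong (λ c → lookup (proj₂ c) v) (circ-indexOf (component h)))
               (componentConnectors-lookup _ v (trans (componentVertex≡componentEdge _ v) (component-self _))))
        where
        open Properties cs
        h = lookup (G v) blue

module Triples where

  open import Data.Nat using (ℕ)
  open import Data.Fin using (Fin; zero; suc)
  open import Data.Fin.Properties using (_≟_; any?; all?)
  open import Data.Vec as V using (Vec; []; _∷_; lookup; tabulate)
  import Data.Vec.Properties as V
  open import Relation.Binary.PropositionalEquality as ≡ using (_≡_; refl; cong; sym; trans)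
  open import Relation.Nullary using (Dec; yes; no)
  open import Data.Product using (∃; _×_; _,_; proj₁; proj₂)
  open import Data.Empty using (⊥-elim)
  open import Defs using (blue)
  open PermutationSign using (injective⇒surjective)
  open Cycles using (lookup-ext)
  open ConnectorSystems

  choose : ∀ {a p} {A : Set a} {P : A → Set p} → A → Dec (∃ P) → A
  choose _ (yes (x , _)) = x
  choose d (no _)        = d

  choose-unique : ∀ {a p} {A : Set a} {P : A → Set p} (d : A) (∃P? : Dec (∃ P)) {x} → P x → (∀ y → P y → y ≡ x) →
                  choose d ∃P? ≡ x
  choose-unique d (yes (y , py)) _  unique = unique y py
  choose-unique d (no ∄P)        px _      = ⊥-elim (∄P (_ , px))

  IsPermutation : ∀ {n} → Vec (Fin n) n → Set
  IsPermutation σ = ∀ i j → lookup σ i ≡ lookup σ j → i ≡ j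

  module _ {n : ℕ} where

    inverse : Vec (Fin n) n → Fin n → Fin n
    inverse σ v = choose v (any? (λ u → lookup σ u ≟ v))

    inverse-lookup : ∀ (σ : Vec (Fin n) n) → IsPermutation σ → ∀ u → inverse σ (lookup σ u) ≡ u
    inverse-lookup σ σ-perm u = choose-unique _ (any? (λ u′ → lookup σ u′ ≟ lookup σ u)) refl (λ y eq → σ-perm y u eq)

    lookup-inverse : ∀ (σ : Vec (Fin n) n) → IsPermutation σ → ∀ v → lookup σ (inverse σ v) ≡ v
    lookup-inverse σ σ-perm v with injective⇒surjective (λ {x} {y} → σ-perm x y) v
    ... | u , refl = cong (lookup σ) (inverse-lookup σ σ-perm u)

    Triple : Set
    Triple = Vec (Fin n) n × Vec (Fin n) n × Vec (Fin n) n

    -- the index (α₁ v, α₂ v, α₃ v, v) of the factor of vertex v in the determinant term of (α₁, α₂, α₃)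
    tupleAt : Triple → Fin n → Vec (Fin n) 4
    tupleAt (a , b , c) v = lookup a v ∷ lookup b v ∷ lookup c v ∷ v ∷ []

  module _ {n m : ℕ} (E : Fin m → Fin 4 → Fin n) where

    Matches : Fin m → Triple → Fin n → Set
    Matches h t v = ∀ i → E h i ≡ lookup (tupleAt t v) i

    matches? : ∀ h t v → Dec (Matches h t v)
    matches? h t v = all? (λ i → E h i ≟ lookup (tupleAt t v) i)

    -- Only good triples contribute to the determinant.
    Good : Triple → Set
    Good t = IsPermutation (proj₁ t) × IsPermutation (proj₁ (proj₂ t)) × IsPermutation (proj₂ (proj₂ t)) ×
             (∀ v → ∃ λ h → Matches h t v)

    tripleOf : (Fin n → Vec (Fin m) 4) → Triple
    tripleOf G = tabulate (α zero) , tabulate (α (suc zero)) , tabulate (α (suc (suc zero)))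
      where open Components E G

    tripleOf-cong : ∀ {G G′ : Fin n → Vec (Fin m) 4} → (∀ v → G v ≡ G′ v) → tripleOf G ≡ tripleOf G′
    tripleOf-cong {G} {G′} G≗G′ = ≡.cong₂ _,_ (tabulate-cong zero) (≡.cong₂ _,_ (tabulate-cong (suc zero)) (tabulate-cong (suc (suc zero))))
      where
      tabulate-cong : ∀ i → tabulate (λ v → E (lookup (G v) blue) i) ≡ tabulate (λ v → E (lookup (G′ v) blue) i)
      tabulate-cong i = V.tabulate-cong (λ v → cong (λ t → E (lookup t blue) i) (G≗G′ v))

    module _ {G : Fin n → Vec (Fin m) 4} (cs : IsConnectorSystem E G) where
      open Properties E cs
      private
        t = tripleOf G
        lookup-α : ∀ i v → lookup (tabulate (α i)) v ≡ α i v
        lookup-α i v = V.lookup∘tabulate (α i) v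

      α-IsPermutation : ∀ i → IsPermutation (tabulate (α i))
      α-IsPermutation i x y eq = α-injective i (trans (sym (lookup-α i x)) (trans eq (lookup-α i y)))

      blue-Matches : ∀ v → Matches (lookup (G v) blue) t v
      blue-Matches v zero                   = sym (lookup-α zero v)
      blue-Matches v (suc zero)             = sym (lookup-α (suc zero) v)
      blue-Matches v (suc (suc zero))       = sym (lookup-α (suc (suc zero)) v)
      blue-Matches v (suc (suc (suc zero))) = isConnector v blue

      tripleOf-Good : Good t
      tripleOf-Good = α-IsPermutation zero , α-IsPermutation (suc zero) , α-IsPermutation (suc (suc zero)) , λ v → _ , blue-Matches v

    -- d is an arbitrary hyperedge, the junk value of edgeAt on tuples that are no hyperedge.
    module _ (E-injective : ∀ a b → (∀ i → E a i ≡ E b i) → a ≡ b) (d : Fin m) where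

      edgeAt : Triple → Fin n → Fin m
      edgeAt t v = choose d (any? (λ h → matches? h t v))

      edgeAt-unique : ∀ t v h → Matches h t v → edgeAt t v ≡ h
      edgeAt-unique t v h h-matches = choose-unique d (any? (λ h → matches? h t v)) h-matches
        (λ h′ h′-matches → E-injective h′ h (λ i → trans (h′-matches i) (sym (h-matches i))))

      connectorsOfTriple : Triple → Fin n → Vec (Fin m) 4
      connectorsOfTriple t@(a , b , c) v = edgeAt t (inverse a v) ∷ edgeAt t (inverse b v) ∷ edgeAt t (inverse c v) ∷ edgeAt t v ∷ []

      module _ {t : Triple} (good : Good t) where
        private
          a = proj₁ t
          b = proj₁ (proj₂ t)
          c = proj₂ (proj₂ t)
          a-perm = proj₁ good
          b-perm = proj₁ (proj₂ good)
          c-perm = proj₁ (proj₂ (proj₂ good))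
          edgeAt-matches : ∀ v → Matches (edgeAt t v) t v
          edgeAt-matches v with proj₂ (proj₂ (proj₂ good)) v
          ... | h , h-matches = ≡.subst (λ h → Matches h t v) (sym (edgeAt-unique t v h h-matches)) h-matches

        connectorsOfTriple-IsConnectorSystem : IsConnectorSystem E (connectorsOfTriple t)
        connectorsOfTriple-IsConnectorSystem = record { isConnector = isConnector ; consistent = consistent }
          where
          isConnector : ∀ v i → E (lookup (connectorsOfTriple t v) i) i ≡ v
          isConnector v zero                = trans (edgeAt-matches (inverse a v) zero) (lookup-inverse a a-perm v)
          isConnector v (suc zero)          = trans (edgeAt-matches (inverse b v) (suc zero)) (lookup-inverse b b-perm v)
          isConnector v (suc (suc zero))    = trans (edgeAt-matches (inverse c v) (suc (suc zero))) (lookup-inverse c c-perm v)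
          isConnector v (suc (suc (suc zero))) = edgeAt-matches v blue
          consistent : ∀ v i → lookup (connectorsOfTriple t (E (lookup (connectorsOfTriple t v) blue) i)) i ≡ lookup (connectorsOfTriple t v) blue
          consistent v zero                = cong (edgeAt t) (trans (cong (inverse a) (edgeAt-matches v zero)) (inverse-lookup a a-perm v))
          consistent v (suc zero)          = cong (edgeAt t) (trans (cong (inverse b) (edgeAt-matches v (suc zero))) (inverse-lookup b b-perm v))
          consistent v (suc (suc zero))    = cong (edgeAt t) (trans (cong (inverse c) (edgeAt-matches v (suc (suc zero)))) (inverse-lookup c c-perm v))
          consistent v (suc (suc (suc zero))) = cong (edgeAt t) (edgeAt-matches v blue)

        tripleOf-connectorsOfTriple : tripleOf (connectorsOfTriple t) ≡ t
        tripleOf-connectorsOfTriple = ≡.cong₂ _,_ (tabulate≡ (λ v → edgeAt-matches v zero))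
                                        (≡.cong₂ _,_ (tabulate≡ (λ v → edgeAt-matches v (suc zero))) (tabulate≡ (λ v → edgeAt-matches v (suc (suc zero)))))
          where
          tabulate≡ : ∀ {i} {σ : Vec (Fin n) n} → (∀ v → E (edgeAt t v) i ≡ lookup σ v) → tabulate (λ v → E (edgeAt t v) i) ≡ σ
          tabulate≡ eq = lookup-ext (λ v → trans (V.lookup∘tabulate _ v) (eq v))

      module _ {G : Fin n → Vec (Fin m) 4} (cs : IsConnectorSystem E G) where
        open Properties E cs
        private
          t = tripleOf G
          lookup-α : ∀ i v → lookup (tabulate (α i)) v ≡ α i v
          lookup-α i v = V.lookup∘tabulate (α i) v

        edgeAt-tripleOf : ∀ v → edgeAt t v ≡ lookup (G v) blue
        edgeAt-tripleOf v = edgeAt-unique t v _ (blue-Matches cs v)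

        connectorsOfTriple-tripleOf : ∀ v → connectorsOfTriple t v ≡ G v
        connectorsOfTriple-tripleOf v = lookup-ext pointwise
          where
          via-α : ∀ i → edgeAt t (inverse (tabulate (α i)) v) ≡ lookup (G v) i
          via-α i with injective⇒surjective (α-injective i) v
          ... | u , refl = trans (cong (edgeAt t) (trans (cong (inverse (tabulate (α i))) (sym (lookup-α i u)))
                                                          (inverse-lookup (tabulate (α i)) (α-IsPermutation cs i) u)))
                                 (trans (edgeAt-tripleOf u) (sym (consistent u i)))
          pointwise : ∀ i → lookup (connectorsOfTriple t v) i ≡ lookup (G v) i
          pointwise zero                   = via-α zero
          pointwise (suc zero)             = via-α (suc zero)
          pointwise (suc (suc zero))       = via-α (suc (suc zero))
          pointwise (suc (suc (suc zero))) = edgeAt-tripleOf v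

module CircuitWeights where

  open import Algebra.Bundles using (CommutativeRing)
  open import Data.Nat as ℕ using (ℕ; zero; suc; _∸_; ⌊_/2⌋)
  import Data.Nat.Properties as ℕ
  open import Data.Fin using (Fin; zero; suc; toℕ)
  open import Data.Vec as V using (Vec; lookup; tabulate)
  import Data.Vec.Properties as V
  open import Data.List using (List; allFin; length)
  open import Data.List.Membership.Propositional using (_∈_)
  open import Data.List.Membership.Propositional.Properties using (∈-allFin)
  import Data.List.Relation.Unary.Unique.Propositional.Properties as Unique
  open import Data.Maybe as Maybe using (Maybe; just)
  import Data.Maybe.Properties as Maybe
  open import Data.Bool using (Bool; true; if_then_else_)
  open import Data.Bool.Properties using () renaming (_≟_ to _≟ᵇ_)
  open import Relation.Binary.PropositionalEquality as ≡ using (_≡_; refl; cong)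
  open import Relation.Nullary using (Dec; yes; ¬_; does)
  open import Relation.Nullary.Decidable using (_×-dec_)
  open import Data.Product using (∃; _×_; _,_; proj₁; proj₂)
  open import Data.Unit using (tt)
  open import Data.Empty using (⊥-elim)
  open import Defs hiding (CycleRep)
  open BigOperators
  open Enumeration using (CycleRep; cycleReps)
  open Cycles using (IsCycle; isCycle; isCycle?; iterate; lookup≡iterate′)
  open CycleSign using (cycleWeight; cycleSign; sgn≈cycleSign)
  open PermutationSign using (module Sign)
  open ConnectorSystems
  open Triples

  module _ {ℓ₁ ℓ₂} (R : CommutativeRing ℓ₁ ℓ₂) {n m : ℕ} (E : Fin m → Fin 4 → Fin n) (x : Fin m → CommutativeRing.Carrier R) where
    open CommutativeRing R hiding (zero; refl)
    open Big *-commutativeMonoid renaming (big to Π)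
    open Sign R using (sgn; sgn-cong)
    import Relation.Binary.Reasoning.Setoid setoid as ≈-Reasoning

    determinantTerm : Triple → Carrier
    determinantTerm (a , b , c) = sign R a * sign R b * sign R c *
      prodL R (allFin n) (λ v → adjacency4 R E x (lookup a v) (lookup b v) (lookup c v) v)

    circuitWeight : CircSet E → Carrier
    circuitWeight P = prodIf R (allFin (length (allCircs E))) (λ j → lookup P j ≟ᵇ true) λ j →
      circuitSign R E (circ E j) * prodIf R (allFin m) (λ h → lookup (proj₁ (circ E j)) h ≟ᵇ true) x

    -- a connector cycle z with |z| = 2(k+1) arcs contributes (-1)^(|z|/2 - 1) = (-1)^k
    connectorCycleWeight≡cycleWeight : ∀ (z : CycleRep n) → negOnePow R (⌊ arcCount E z /2⌋ ∸ 1) ≡ cycleWeight R z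
    connectorCycleWeight≡cycleWeight (k , _) = cong (λ q → negOnePow R (q ∸ 1))
      (≡.trans (cong (λ q → ⌊ suc k ℕ.+ q /2⌋) (ℕ.+-identityʳ (suc k))) (≡.sym (ℕ.n≡⌊n+n/2⌋ (suc k))))

    module _ (E-injective : ∀ a b → (∀ i → E a i ≡ E b i) → a ≡ b) (d : Fin m) {P : CircSet E} (partition : IsCircuitPartition E P) where
      open ConnectorsOf E d
      private
        G = connectorsOf P
        cs = connectorsOf-IsConnectorSystem {P = P} partition
        Conn⇒≡ = connectorsOf-Conn {P = P} partition
        covering = connectorsOf-covering {P = P} partition
        Covers⇒≡ = Covers-unique {P = P} partition
        circuits = proj₁ partition
        circuit-exactlyOne = λ j (j∈ : Member E P j) → proj₁ (proj₂ (circuits j j∈))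
        circuit-edges∈ = λ j (j∈ : Member E P j) → proj₁ (proj₂ (proj₂ (circuits j j∈)))
        S : Fin (length (allCircs E)) → Vec Bool m
        S j = proj₁ (circ E j)
        C : Fin (length (allCircs E)) → Vec (Maybe (Vec (Fin m) 4)) n
        C j = connsOf E j
      open Properties E cs


      circuitEdge-blue : ∀ {j h} → Member E P j → InS E (S j) h → ∃ λ w → Conn E (C j) w (G w) × lookup (G w) blue ≡ h
      circuitEdge-blue {j} {h} j∈ h∈ with circuit-exactlyOne j j∈ h h∈ blue
      ... | w , (t , eq , t₃≡h) , _ = w , ≡.trans eq (cong just (≡.sym Gw≡t)) , ≡.trans (cong (λ t → lookup t blue) Gw≡t) t₃≡h
        where Gw≡t = Conn⇒≡ w j j∈ eq

      blue-injective : ∀ {u w} → lookup (G u) blue ≡ lookup (G w) blue → u ≡ w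
      blue-injective {u} {w} eq = ≡.trans (≡.sym (isConnector u blue)) (≡.trans (cong (λ h → E h blue) eq) (isConnector w blue))

      InCircuit : Fin (length (allCircs E)) → Fin m → Set
      InCircuit j h = Member E P j × InS E (S j) h

      inCircuit? : ∀ j h → Dec (InCircuit j h)
      inCircuit? j h = (lookup P j ≟ᵇ true) ×-dec (lookup (S j) h ≟ᵇ true)

      Used⇒InCircuit! : ∀ {h} → Used h → ∃ λ j → j ∈ allFin _ × InCircuit j h × (∀ {j′} → j′ ∈ allFin _ → InCircuit j′ h → j′ ≡ j)
      Used⇒InCircuit! (u , refl) with covering u
      ... | j , j∈ , eq = j , ∈-allFin j , (j∈ , circuit-edges∈ j j∈ u (G u) eq blue) , unique
        where
        unique : ∀ {j′} → j′ ∈ allFin _ → InCircuit j′ (lookup (G u) blue) → j′ ≡ j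
        unique {j′} _ (j′∈ , h∈) with circuitEdge-blue j′∈ h∈
        ... | w , eq′ , blue≡ = Covers⇒≡ u j j′ (j∈ , G u , eq , tt)
                                  (j′∈ , ≡.subst (λ v → LiesIn E v (C j′)) (blue-injective blue≡) (G w , eq′ , tt))

      ¬Used⇒¬InCircuit : ∀ {h} → ¬ Used h → ∀ {j} → j ∈ allFin _ → ¬ InCircuit j h
      ¬Used⇒¬InCircuit ¬used _ (j∈ , h∈) with circuitEdge-blue j∈ h∈
      ... | w , _ , blue≡ = ¬used (w , blue≡)

      LiesIn⇒Conn : ∀ j → Member E P j → ∀ {u} → LiesIn E u (C j) → Conn E (C j) u (G u)
      LiesIn⇒Conn j j∈ (t , eq , _) = ≡.trans eq (cong just (≡.sym (Conn⇒≡ _ j j∈ eq)))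

      LiesIn-α : ∀ col j → Member E P j → ∀ {u} → LiesIn E u (C j) → LiesIn E (α col u) (C j)
      LiesIn-α col j j∈ {u} u∈ with circuit-exactlyOne j j∈ (lookup (G u) blue) (circuit-edges∈ j j∈ u (G u) (LiesIn⇒Conn j j∈ u∈) blue) col
      ... | w , (t , eq , t-col≡) , _ = ≡.subst (λ v → LiesIn E v (C j)) (≡.sym αu≡w) (t , eq , tt)
        where
        αu≡w : α col u ≡ w
        αu≡w = ≡.trans (cong (λ h → E h col) (≡.sym t-col≡)) (proj₁ (circuits j j∈) w t eq col)

      LiesIn-iterate : ∀ col j → Member E P j → ∀ {u} → LiesIn E u (C j) → ∀ i → LiesIn E (iterate (α col) i u) (C j)
      LiesIn-iterate col j j∈ u∈ zero    = u∈
      LiesIn-iterate col j j∈ u∈ (suc i) = LiesIn-α col j j∈ (LiesIn-iterate col j j∈ u∈ i)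

      ConnectorCycle⇒IsCycle : ∀ col j → Member E P j → ∀ {k zs} → IsConnectorCycle E col (circ E j) (k , zs) →
                               IsCycle (α col) (k , zs) × LiesIn E (lookup zs zero) (C j)
      ConnectorCycle⇒IsCycle col j j∈ {k} {zs} (arcs , distinct , _ , canonical) =
        isCycle step distinct canonical , (proj₁ (arcs zero) , proj₁ (proj₂ (arcs zero)) , tt)
        where
        step : ∀ i → lookup zs (next i) ≡ α col (lookup zs i)
        step i with arcs i
        ... | t , eq , _ , t′ , eq′ , t′-col≡ = begin
          lookup zs (next i)              ≡⟨ isConnector _ col ⟨
          E (lookup (G (lookup zs (next i))) col) col ≡⟨ cong (λ t → E (lookup t col) col) (Conn⇒≡ _ j j∈ eq′) ⟩
          E (lookup t′ col) col           ≡⟨ cong (λ h → E h col) t′-col≡ ⟩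
          E (lookup t blue) col           ≡⟨ cong (λ t → E (lookup t blue) col) (Conn⇒≡ _ j j∈ eq) ⟨
          α col (lookup zs i)             ∎
          where open ≡.≡-Reasoning

      IsCycle⇒ConnectorCycle : ∀ col j → Member E P j → ∀ {k zs} → IsCycle (α col) (k , zs) → LiesIn E (lookup zs zero) (C j) →
                               IsConnectorCycle E col (circ E j) (k , zs)
      IsCycle⇒ConnectorCycle col j j∈ {k} {zs} c head∈ = arcs , IsCycle.injective c , blues-distinct , IsCycle.headMinimal c
        where
        conn : ∀ i → Conn E (C j) (lookup zs i) (G (lookup zs i))
        conn i = LiesIn⇒Conn j j∈ (≡.subst (λ v → LiesIn E v (C j)) (≡.sym (lookup≡iterate′ c i)) (LiesIn-iterate col j j∈ head∈ (toℕ i)))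
        arcs : ∀ i → ∃ λ t → Conn E (C j) (lookup zs i) t × (InS E (S j) (lookup t blue) ×
                 (∃ λ t′ → Conn E (C j) (lookup zs (next i)) t′ × lookup t′ col ≡ lookup t blue))
        arcs i = G (lookup zs i) , conn i , circuit-edges∈ j j∈ _ _ (conn i) blue , G (lookup zs (next i)) , conn (next i) ,
                 ≡.trans (cong (λ v → lookup (G v) col) (IsCycle.step c i)) (consistent (lookup zs i) col)
        blues-distinct : ∀ a b → blueOf E (C j) (lookup zs a) ≡ blueOf E (C j) (lookup zs b) → a ≡ b
        blues-distinct a b eq = IsCycle.injective c a b (blue-injective (Maybe.just-injective
          (≡.trans (≡.sym (cong (Maybe.map (λ t → lookup t blue)) (conn a))) (≡.trans eq (cong (Maybe.map (λ t → lookup t blue)) (conn b))))))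

      private
        circuitIndices = allFin (length (allCircs E))
        ifMember : Fin (length (allCircs E)) → Carrier → Carrier
        ifMember j u = if does (lookup P j ≟ᵇ true) then u else 1#
        usedProduct : Carrier
        usedProduct = Π (allFin m) (λ h → if does (used? h) then x h else 1#)
        A : Fin 4 → Vec (Fin n) n
        A col = tabulate (α col)

      Π-circuitEdges≈usedProduct :
        Π circuitIndices (λ j → ifMember j (prodIf R (allFin m) (λ h → lookup (S j) h ≟ᵇ true) x)) ≈ usedProduct
      Π-circuitEdges≈usedProduct =
        trans (big-cong′ circuitIndices λ j → trans (if-big _ (allFin m) _) (big-cong′ (allFin m) λ h →
                 reflexive (if-∧ (does (lookup P j ≟ᵇ true)) (does (lookup (S j) h ≟ᵇ true)))))
              (big-regroup circuitIndices (allFin m) (Unique.allFin⁺ _) inCircuit? used? x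
                (λ _ → Used⇒InCircuit!) (λ _ → ¬Used⇒¬InCircuit))

      Π-blueEdges≈usedProduct : Π (allFin n) (λ v → x (lookup (G v) blue)) ≈ usedProduct
      Π-blueEdges≈usedProduct = big-reindex (allFin n) (allFin m) (Unique.allFin⁺ n) (Unique.allFin⁺ m) (λ _ → yes tt) used?
        (λ v → x (lookup (G v) blue)) (λ h → if does (used? h) then x h else 1#) (λ v → lookup (G v) blue) (λ h → E h blue)
        (λ _ ¬tt → ⊥-elim (¬tt tt)) (λ {h} _ ¬used → reflexive (if-no (used? h) ¬used))
        (λ {v} _ _ → ∈-allFin _ , (v , refl) , isConnector v blue , reflexive (if-yes (used? _) (v , refl)))
        (λ {h} _ used → ∈-allFin _ , tt , Used⇒blue-end used)
        where
        Used⇒blue-end : ∀ {h} → Used h → lookup (G (E h blue)) blue ≡ h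
        Used⇒blue-end (u , refl) = cong (λ v → lookup (G v) blue) (isConnector u blue)

      Π-entries≈Π-blueEdges :
        prodL R (allFin n) (λ v → adjacency4 R E x (lookup (A zero) v) (lookup (A (suc zero)) v) (lookup (A (suc (suc zero))) v) v)
        ≈ Π (allFin n) (λ v → x (lookup (G v) blue))
      Π-entries≈Π-blueEdges = big-cong′ (allFin n) λ v →
        trans (Big.big-single +-commutativeMonoid (allFin m) (Unique.allFin⁺ m) (∈-allFin (lookup (G v) blue))
                 (λ {h} _ h≢ → reflexive (if-no (matches? E h (tripleOf E G) v)
                   (λ h-matches → h≢ (E-injective h _ (λ i → ≡.trans (h-matches i) (≡.sym (blue-Matches E cs v i))))))))
              (reflexive (if-yes (matches? E _ (tripleOf E G) v) (blue-Matches E cs v)))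

      private
        InCircuitᶜ : Fin 4 → Fin (length (allCircs E)) → CycleRep n → Set
        InCircuitᶜ col j z = Member E P j × IsConnectorCycle E col (circ E j) z

        inCircuitᶜ? : ∀ col j z → Dec (InCircuitᶜ col j z)
        inCircuitᶜ? col j z = (lookup P j ≟ᵇ true) ×-dec isConnectorCycle? E col (circ E j) z

        IsCycle⇒InCircuitᶜ! : ∀ col {z} → IsCycle (α col) z →
          ∃ λ j → j ∈ circuitIndices × InCircuitᶜ col j z × (∀ {j′} → j′ ∈ circuitIndices → InCircuitᶜ col j′ z → j′ ≡ j)
        IsCycle⇒InCircuitᶜ! col {k , zs} c with covering (lookup zs zero)
        ... | j , j∈ , eq = j , ∈-allFin j , (j∈ , IsCycle⇒ConnectorCycle col j j∈ c (G (lookup zs zero) , eq , tt)) ,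
          λ {j′} _ (j′∈ , cyc) → Covers⇒≡ (lookup zs zero) j j′ (j∈ , G (lookup zs zero) , eq , tt)
                                   (j′∈ , proj₂ (ConnectorCycle⇒IsCycle col j′ j′∈ {k} {zs} cyc))

        ¬IsCycle⇒¬InCircuitᶜ : ∀ col {z} → ¬ IsCycle (α col) z → ∀ {j} → j ∈ circuitIndices → ¬ InCircuitᶜ col j z
        ¬IsCycle⇒¬InCircuitᶜ col {k , zs} ¬c {j} _ (j∈ , cyc) = ¬c (proj₁ (ConnectorCycle⇒IsCycle col j j∈ {k} {zs} cyc))

        connectorCycleWeight : CycleRep n → Carrier
        connectorCycleWeight z = negOnePow R (⌊ arcCount E z /2⌋ ∸ 1)

      -- the connector cycles of colour col in the circuits of P are exactly the cycles of α col
      Π-connectorCycles≈cycleSign : ∀ col →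
        Π circuitIndices (λ j → ifMember j (prodIf R (cycleReps n) (isConnectorCycle? E col (circ E j)) connectorCycleWeight))
        ≈ cycleSign R (α col)
      Π-connectorCycles≈cycleSign col = begin
        Π circuitIndices (λ j → ifMember j (prodIf R (cycleReps n) (isConnectorCycle? E col (circ E j)) connectorCycleWeight))
          ≈⟨ big-cong′ circuitIndices (λ j → trans (if-big _ (cycleReps n) _) (big-cong′ (cycleReps n) λ z →
               reflexive (if-∧ (does (lookup P j ≟ᵇ true)) (does (isConnectorCycle? E col (circ E j) z))))) ⟩
        Π circuitIndices (λ j → Π (cycleReps n) (λ z → if does (inCircuitᶜ? col j z) then connectorCycleWeight z else 1#))
          ≈⟨ big-regroup circuitIndices (cycleReps n) (Unique.allFin⁺ _) (inCircuitᶜ? col) (isCycle? (α col)) connectorCycleWeight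
               (λ _ → IsCycle⇒InCircuitᶜ! col) (λ _ → ¬IsCycle⇒¬InCircuitᶜ col) ⟩
        Π (cycleReps n) (λ z → if does (isCycle? (α col) z) then connectorCycleWeight z else 1#)
          ≈⟨ big-cong′ (cycleReps n) (λ z → reflexive (cong (λ w → if does (isCycle? (α col) z) then w else 1#)
                                                              (connectorCycleWeight≡cycleWeight z))) ⟩
        cycleSign R (α col) ∎
        where open ≈-Reasoning

      Π-circuitSigns≈Π-signs : Π circuitIndices (λ j → ifMember j (circuitSign R E (circ E j))) ≈ Π colours (λ col → sign R (A col))
      Π-circuitSigns≈Π-signs = begin
        Π circuitIndices (λ j → ifMember j (circuitSign R E (circ E j)))
          ≈⟨ big-cong′ circuitIndices (λ j → if-big (does (lookup P j ≟ᵇ true)) colours (connectorCycles j)) ⟩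
        Π circuitIndices (λ j → Π colours (λ col → ifMember j (prodIf R (cycleReps n) (isConnectorCycle? E col (circ E j)) connectorCycleWeight)))
          ≈⟨ big-comm circuitIndices colours (λ j col → ifMember j (connectorCycles j col)) ⟩
        Π colours (λ col → Π circuitIndices (λ j → ifMember j (prodIf R (cycleReps n) (isConnectorCycle? E col (circ E j)) connectorCycleWeight)))
          ≈⟨ big-cong′ colours Π-connectorCycles≈cycleSign ⟩
        Π colours (λ col → cycleSign R (α col))
          ≈⟨ big-cong′ colours (λ col → sym (sgn≈cycleSign R (α col) (α-injective col))) ⟩
        Π colours (λ col → sgn (α col))
          ≈⟨ big-cong′ colours (λ col → sgn-cong (λ v → ≡.sym (V.lookup∘tabulate (α col) v))) ⟩
        Π colours (λ col → sign R (A col)) ∎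
        where
        open ≈-Reasoning
        connectorCycles : Fin (length (allCircs E)) → Fin 4 → Carrier
        connectorCycles j col = prodIf R (cycleReps n) (isConnectorCycle? E col (circ E j)) connectorCycleWeight

      circuitWeight≈determinantTerm : circuitWeight P ≈ determinantTerm (tripleOf E (connectorsOf P))
      circuitWeight≈determinantTerm = begin
        circuitWeight P
          ≈⟨ big-cong′ circuitIndices (λ j → if-∙ (does (lookup P j ≟ᵇ true)) _ _) ⟩
        Π circuitIndices (λ j → ifMember j (circuitSign R E (circ E j)) * ifMember j (edgeProduct j))
          ≈⟨ big-distrib circuitIndices _ _ ⟩
        Π circuitIndices (λ j → ifMember j (circuitSign R E (circ E j))) * Π circuitIndices (λ j → ifMember j (edgeProduct j))
          ≈⟨ *-cong Π-circuitSigns≈Π-signs (trans Π-circuitEdges≈usedProduct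
                                              (trans (sym Π-blueEdges≈usedProduct) (sym Π-entries≈Π-blueEdges))) ⟩
        (sign R (A zero) * (sign R (A (suc zero)) * (sign R (A (suc (suc zero))) * 1#))) * entries
          ≈⟨ *-congʳ (trans (*-congˡ (*-congˡ (*-identityʳ _))) (sym (*-assoc _ _ _))) ⟩
        determinantTerm (tripleOf E (connectorsOf P)) ∎
        where
        open ≈-Reasoning
        edgeProduct : Fin (length (allCircs E)) → Carrier
        edgeProduct j = prodIf R (allFin m) (λ h → lookup (S j) h ≟ᵇ true) x
        entries = prodL R (allFin n) (λ v → adjacency4 R E x (lookup (A zero) v) (lookup (A (suc zero)) v) (lookup (A (suc (suc zero))) v) v)

module DeterminantExpansion where

  open import Algebra.Bundles using (CommutativeRing)
  open import Data.Nat using (ℕ; zero; suc)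
  open import Data.Fin using (Fin; zero; suc)
  import Data.Fin.Properties as Fin
  open import Data.Vec using (Vec; lookup)
  open import Data.List using (allFin; length; cartesianProduct)
  open import Data.List.Membership.Propositional using (_∈_)
  open import Data.List.Membership.Propositional.Properties using (∈-allFin; ∈-cartesianProduct⁺)
  import Data.List.Relation.Unary.Unique.Propositional.Properties as Unique
  open import Data.Bool using (true; false; if_then_else_)
  open import Relation.Binary.PropositionalEquality as ≡ using (_≡_)
  open import Relation.Nullary using (Dec; yes; no; ¬_; does)
  open import Relation.Nullary.Decidable using (_×-dec_)
  open import Data.Product using (_×_; _,_)
  open import Defs
  open BigOperators
  open Enumeration using (∈-vecs; vecs⁺-Unique; ∈-bools; bools⁺-Unique)
  open ConnectorSystems
  open Triples
  open CircuitWeights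

  module _ {ℓ₁ ℓ₂} (R : CommutativeRing ℓ₁ ℓ₂) {n m : ℕ} (E : Fin m → Fin 4 → Fin n) (x : Fin m → CommutativeRing.Carrier R) where
    open CommutativeRing R hiding (zero) renaming (refl to ≈-refl)
    open Big +-commutativeMonoid renaming (big to Σ)
    import Relation.Binary.Reasoning.Setoid setoid as ≈-Reasoning

    private
      if-congˡ : ∀ b {u u′ : Carrier} → u ≈ u′ → (if b then u else 0#) ≈ (if b then u′ else 0#)
      if-congˡ true  u≈u′ = u≈u′
      if-congˡ false _    = ≈-refl

      permutations = vecs (allFin n) n

    triples : Data.List.List Triple
    triples = cartesianProduct permutations (cartesianProduct permutations permutations)

    term : Triple → Carrier
    term t@(a , b , c) = if does (isPerm? R a) then (if does (isPerm? R b) then (if does (isPerm? R c) then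
                           determinantTerm R E x t else 0#) else 0#) else 0#

    det≈Σ-terms : det R (adjacency4 R E x) ≈ Σ triples term
    det≈Σ-terms = begin
      det R (adjacency4 R E x)
        ≈⟨ big-cong′ permutations (λ a → trans (if-big (does (isPerm? R a)) permutations _)
             (big-cong′ permutations (λ b → trans (if-congˡ (does (isPerm? R a)) (if-big (does (isPerm? R b)) permutations _))
                                                  (if-big (does (isPerm? R a)) permutations _)))) ⟩
      Σ permutations (λ a → Σ permutations (λ b → Σ permutations (λ c → term (a , b , c))))
        ≈⟨ big-cong′ permutations (λ a → sym (big-cartesianProduct permutations permutations (λ bc → term (a , bc)))) ⟩
      Σ permutations (λ a → Σ (cartesianProduct permutations permutations) (λ bc → term (a , bc)))
        ≈⟨ big-cartesianProduct permutations (cartesianProduct permutations permutations) term ⟨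
      Σ triples term ∎
      where open ≈-Reasoning

    good? : ∀ t → Dec (Good E t)
    good? t@(a , b , c) = isPerm? R a ×-dec isPerm? R b ×-dec isPerm? R c ×-dec
                          Fin.all? (λ v → Fin.any? (λ h → matches? E h t v))

    term-Good : ∀ {t} → Good E t → term t ≈ determinantTerm R E x t
    term-Good {a , b , c} (a-perm , b-perm , c-perm , _) =
      reflexive (≡.trans (if-yes (isPerm? R a) a-perm) (≡.trans (if-yes (isPerm? R b) b-perm) (if-yes (isPerm? R c) c-perm)))

    -- if the tuple of some vertex v is no hyperedge, the factor of v in the term vanishes
    term-¬Good : ∀ t → ¬ Good E t → term t ≈ 0#
    term-¬Good t@(a , b , c) ¬good = byPermutations (isPerm? R a) (isPerm? R b) (isPerm? R c)
      where
      open Big *-commutativeMonoid using () renaming (big-extract to Π-extract)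
      byPermutations : (a? : Dec (IsPermutation a)) (b? : Dec (IsPermutation b)) (c? : Dec (IsPermutation c)) →
        (if does a? then (if does b? then (if does c? then determinantTerm R E x t else 0#) else 0#) else 0#) ≈ 0#
      byPermutations (no _)  _       _       = ≈-refl
      byPermutations (yes _) (no _)  _       = ≈-refl
      byPermutations (yes _) (yes _) (no _)  = ≈-refl
      byPermutations (yes a-perm) (yes b-perm) (yes c-perm)
        with Fin.¬∀⟶∃¬ n _ (λ v → Fin.any? (λ h → matches? E h t v)) (λ all → ¬good (a-perm , b-perm , c-perm , all))
      ... | v , no-edge = trans (*-congˡ (trans (Π-extract Fin._≟_ (allFin n) (Unique.allFin⁺ n) (∈-allFin v))
                                                 (trans (*-congʳ entry≈0) (zeroˡ _)))) (zeroʳ _)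
        where
        entry≈0 : adjacency4 R E x (lookup a v) (lookup b v) (lookup c v) v ≈ 0#
        entry≈0 = big-ε (allFin m) (λ {h} _ → reflexive (if-no (matches? E h t v) (λ h-matches → no-edge (h , h-matches))))

    module _ (E-injective : ∀ a b → (∀ i → E a i ≡ E b i) → a ≡ b) (d : Fin m) where
      open ConnectorsOf E d

      partitionOf : Triple → CircSet E
      partitionOf t = circuitsOf E (connectorsOfTriple E E-injective d t)

      tripleOfPartition : CircSet E → Triple
      tripleOfPartition P = tripleOf E (connectorsOf P)

      partitionTerm : CircSet E → Carrier
      partitionTerm P = if does (isCircuitPartition? E P) then circuitWeight R E x P else 0#

      partitions : Data.List.List (CircSet E)
      partitions = vecs bools (length (allCircs E))

      private

        to : ∀ {t} → t ∈ triples → Good E t →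
             partitionOf t ∈ partitions × IsCircuitPartition E (partitionOf t) × tripleOfPartition (partitionOf t) ≡ t ×
             partitionTerm (partitionOf t) ≈ term t
        to {t} _ good = ∈-vecs ∈-bools _ , partition , round-trip , (begin
            partitionTerm (partitionOf t)                           ≡⟨ if-yes (isCircuitPartition? E (partitionOf t)) partition ⟩
            circuitWeight R E x (partitionOf t)                     ≈⟨ circuitWeight≈determinantTerm R E x E-injective d {P = partitionOf t} partition ⟩
            determinantTerm R E x (tripleOfPartition (partitionOf t)) ≡⟨ ≡.cong (determinantTerm R E x) round-trip ⟩
            determinantTerm R E x t                                 ≈⟨ term-Good {t = t} good ⟨
            term t                                                  ∎)
          where
          open ≈-Reasoning
          cs = connectorsOfTriple-IsConnectorSystem E E-injective d {t = t} good
          partition : IsCircuitPartition E (partitionOf t)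
          partition = circuitsOf-IsCircuitPartition E cs
          round-trip : tripleOfPartition (partitionOf t) ≡ t
          round-trip = ≡.trans (tripleOf-cong E {G = connectorsOf (partitionOf t)} {G′ = connectorsOfTriple E E-injective d t}
                                              (connectorsOf-circuitsOf {G = connectorsOfTriple E E-injective d t} cs))
                               (tripleOf-connectorsOfTriple E E-injective d {t = t} good)

        from : ∀ {P} → P ∈ partitions → IsCircuitPartition E P →
               tripleOfPartition P ∈ triples × Good E (tripleOfPartition P) × partitionOf (tripleOfPartition P) ≡ P
        from {P} _ partition =
          ∈-cartesianProduct⁺ (∈-vecs ∈-allFin _) (∈-cartesianProduct⁺ (∈-vecs ∈-allFin _) (∈-vecs ∈-allFin _)) , good ,
          circuitsOf≡ {P = P} partition {G′ = connectorsOfTriple E E-injective d (tripleOfPartition P)}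
            (connectorsOfTriple-IsConnectorSystem E E-injective d {t = tripleOfPartition P} good)
            (connectorsOfTriple-tripleOf E E-injective d {G = connectorsOf P} cs)
          where
          cs = connectorsOf-IsConnectorSystem {P = P} partition
          good = tripleOf-Good E {G = connectorsOf P} cs

      Σ-terms≈Σ-partitionTerms : Σ triples term ≈ Σ partitions partitionTerm
      Σ-terms≈Σ-partitionTerms = big-reindex {P = Good E} {Q = IsCircuitPartition E} triples partitions
        (Unique.cartesianProduct⁺ unique (Unique.cartesianProduct⁺ unique unique)) (vecs⁺-Unique bools⁺-Unique (length (allCircs E)))
        good? (isCircuitPartition? E) term partitionTerm partitionOf tripleOfPartition
        (λ {t} _ → term-¬Good t) (λ {P} _ ¬partition → reflexive (if-no (isCircuitPartition? E P) ¬partition)) to from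
        where unique = vecs⁺-Unique (Unique.allFin⁺ n) n

      det≈circuitExpansion : det R (adjacency4 R E x) ≈ circuitExpansion R E x
      det≈circuitExpansion = begin
        det R (adjacency4 R E x)       ≈⟨ det≈Σ-terms ⟩
        Σ triples term                 ≈⟨ Σ-terms≈Σ-partitionTerms ⟩
        Σ partitions partitionTerm     ≡⟨⟩
        circuitExpansion R E x         ∎
        where open ≈-Reasoning

  module _ {ℓ₁ ℓ₂} (R : CommutativeRing ℓ₁ ℓ₂) where
    open CommutativeRing R hiding (zero) renaming (refl to ≈-refl)
    open Big +-commutativeMonoid using (big-ε)

    -- with no vertices both sides are the empty product 1
    noVertices : (E : Fin 0 → Fin 4 → Fin 0) (x : Fin 0 → Carrier) → det R (adjacency4 R E x) ≈ circuitExpansion R E x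
    noVertices E x = trans (det≈Σ-terms R E x) (trans Σ≈1 (sym expansion≈1))
      where
      Σ≈1 : Big.big +-commutativeMonoid (triples R E x) (term R E x) ≈ 1#
      Σ≈1 = trans (+-identityʳ _) (trans (*-identityʳ _) (trans (*-identityʳ _) (*-identityʳ _)))
      expansion≈1 : circuitExpansion R E x ≈ 1#
      expansion≈1 = trans (+-identityˡ _) (trans (+-identityʳ _) (*-identityʳ _))

    -- with vertices but no hyperedges, every entry of A(D,x) and every circuit partition vanish
    noHyperedges : ∀ n (E : Fin 0 → Fin 4 → Fin (suc n)) (x : Fin 0 → Carrier) → det R (adjacency4 R E x) ≈ circuitExpansion R E x
    noHyperedges n E x = trans (det≈Σ-terms R E x) (trans (big-ε (triples R E x) (λ {t} _ → term≈0 t)) (sym expansion≈0))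
      where
      if≈0 : ∀ b {u} → u ≈ 0# → (if b then u else 0#) ≈ 0#
      if≈0 true  u≈0 = u≈0
      if≈0 false _   = ≈-refl
      term≈0 : ∀ t → term R E x t ≈ 0#
      term≈0 (a , b , c) = if≈0 (does (isPerm? R a)) (if≈0 (does (isPerm? R b)) (if≈0 (does (isPerm? R c))
                             (trans (*-congˡ (zeroˡ _)) (zeroʳ _))))
      noPartition : ∀ P → ¬ IsCircuitPartition E P
      noPartition P (_ , _ , covering) with covering zero
      ... | _ , _ , t , _ with lookup t zero
      ...   | ()
      expansion≈0 : circuitExpansion R E x ≈ 0#
      expansion≈0 = big-ε (vecs bools (length (allCircs E))) (λ {P} _ → reflexive (if-no (isCircuitPartition? E P) (noPartition P)))

open DeterminantExpansion

proposition3p10 : ∀ {c ℓ} (R : CommutativeRing c ℓ) (n m : ℕ)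
    (E : Fin m → Fin 4 → Fin n)
    → (∀ a i j → E a i ≡ E a j → i ≡ j)
    → (∀ a b → (∀ i → E a i ≡ E b i) → a ≡ b)
    → (x : Fin m → CommutativeRing.Carrier R)
    → CommutativeRing._≈_ R (det R (adjacency4 R E x)) (circuitExpansion R E x)
proposition3p10 R n       (suc m) E _ E-injective x = det≈circuitExpansion R E x E-injective zero
proposition3p10 R zero    zero    E _ _           x = noVertices R E x
proposition3p10 R (suc n) zero    E _ _           x = noHyperedges R n E x
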